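{- For an integer $n\ge 1$ let $L_n$ be the set of all subsets of $[n]=\{1,2,\ldots,n\}$ that are arithmetic progressions, partially ordered by inclusion, and let $L_0=\{\emptyset\}$. Let $\mu_n$ denote the Möbius function of $L_n$ and write $\mu_n(L_n)=\mu_n(\emptyset,[n])$ (with $\mu_0(L_0)=\mu_0(\emptyset,\emptyset)$). Then $\mu_0(L_0)=1$, $\mu_1(L_1)=-1$, and $\mu_n(L_n)=\mu(n-1)$ for all $n\ge 2$, where $\mu$ is the classical number-theoretic Möbius function.
   Context: An arithmetic progression in $[n]$ is a set of the form $\{a,a+r,\ldots,a+(k-1)r\}\subseteq[n]$ with integers $a$, $r\ge 1$, $k\ge 0$; this includes the empty set, all singletons and all $2$-element subsets. $L_n$ is a lattice with minimum $\emptyset$, maximum $[n]$, and meet given by intersection. The Möbius function of a finite poset $X$ is defined on pairs $x\le y$ by $\mu_X(x,x)=1$ and $\mu_X(x,y)=-\sum_{x\le z<y}\mu_X(x,z)$ for $x<y$. The classical Möbius function: $\mu(1)=1$, $\mu(s)=(-1)^j$ if $s$ is a product of $j$ distinct primes, and $\mu(s)=0$ if $s$ is divisible by the square of a prime. -}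

module Defs where

open import Data.Nat using (ℕ; zero; suc; _+_; _*_; _∸_; _≤_; _<_; z≤n; s≤s)
open import Data.Nat.Properties using (anyUpTo?; allUpTo?; ≤-trans; m≤m+n; m≤n+m; m+n≤o⇒m≤o; m+n≤o⇒n≤o; m≤m*n; +-identityʳ; m≤n⇒m≤1+n; _≟_; _≤?_)
open import Data.Nat.Divisibility using (_∣_; _∣?_)
open import Data.Nat.Primality using (Prime; prime?)
open import Data.Integer as ℤ using (ℤ; -_)
open import Data.Fin using (Fin; toℕ)
open import Data.Fin.Properties using (all?)
open import Data.Fin.Subset using (Subset; _∈_; _⊆_; _⊂_; ⊥; ⊤; inside; outside)
open import Data.Fin.Subset.Properties using (_∈?_; _⊆?_)
open import Data.Bool using (Bool)
open import Data.Vec using (Vec; []; _∷_)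
open import Data.Vec.Properties using (≡-dec)
import Data.Bool.Properties as BoolP
open import Data.List using (List; []; _∷_; _++_; map; filter; length; upTo)
open import Data.Product using (Σ; ∃; _×_; _,_; proj₁; proj₂)
open import Function.Bundles using (_⇔_; mk⇔; Equivalence)
open import Relation.Nullary using (Dec; yes; no; ¬_)
open import Relation.Nullary.Decidable using (_×-dec_; _→-dec_; ¬?)
open import Relation.Binary.PropositionalEquality using (_≡_; refl; subst; cong)
open import Relation.Binary.Definitions using (DecidableEquality) renaming (Decidable to Decidable₂)

-- A finite poset is given by its carrier A, decidable equality,
-- a decidable order _≤_, and a duplicate-free list `elems` of all of
-- its elements.
-- The recursion is well-founded (it descends along strict chains
-- ending in y); we implement it with a fuel argument equal to the
-- number of elements, which bounds the length of every strict chain,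
-- so the fuel never runs out on pairs x ≤ y.

module MoebiusFinPoset {A : Set} (_≟A_ : DecidableEquality A)
         {_≼_ : A → A → Set} (_≼?_ : Decidable₂ _≼_) (elems : List A) where

  sumℤ : List ℤ → ℤ
  sumℤ []       = ℤ.0ℤ
  sumℤ (x ∷ xs) = x ℤ.+ sumℤ xs

  below : A → A → List A
  below x y = filter (λ z → (x ≼? z) ×-dec ((z ≼? y) ×-dec ¬? (z ≟A y))) elems

  μ-fuel : ℕ → A → A → ℤ
  μ-fuel zero     x y = ℤ.0ℤ
  μ-fuel (suc f)  x y with x ≟A y
  ... | yes _ = ℤ.1ℤ
  ... | no  _ = - sumℤ (map (μ-fuel f x) (below x y))

  μP : A → A → ℤ
  μP = μ-fuel (length elems)

-- Arithmetic progressions in [n] = {1,…,n}.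
-- Subsets of [n] are `Subset n`; the element i : Fin n stands for the
-- integer toℕ i + 1.

APMem : ℕ → ℕ → ℕ → ℕ → Set
APMem a r k x = ∃ λ j → j < k × x ≡ a + j * r

APInRange : ℕ → ℕ → ℕ → ℕ → Set
APInRange n a r k = ∀ {j} → j < k → 1 ≤ a + j * r × a + j * r ≤ n

IsAPWith : ∀ {n} → Subset n → ℕ → ℕ → ℕ → Set
IsAPWith {n} S a r k =
  1 ≤ r × APInRange n a r k × (∀ (i : Fin n) → (i ∈ S ⇔ APMem a r k (suc (toℕ i))))

IsAP : ∀ {n} → Subset n → Set
IsAP S = ∃ λ a → ∃ λ r → ∃ λ k → IsAPWith S a r k

private
  iff? : ∀ {P Q : Set} → Dec P → Dec Q → Dec (P ⇔ Q)
  iff? p q with p →-dec q | q →-dec p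
  ... | yes f | yes g = yes (mk⇔ f g)
  ... | no ¬f | _     = no λ e → ¬f (Equivalence.to e)
  ... | _     | no ¬g = no λ e → ¬g (Equivalence.from e)

  APMem? : ∀ a r k x → Dec (APMem a r k x)
  APMem? a r k x = anyUpTo? (λ j → x ≟ a + j * r) k

  IsAPWith? : ∀ {n} (S : Subset n) a r k → Dec (IsAPWith S a r k)
  IsAPWith? {n} S a r k =
    (1 ≤? r) ×-dec (allUpTo? (λ j → (1 ≤? a + j * r) ×-dec (a + j * r ≤? n)) k
             ×-dec all? (λ i → iff? (i ∈? S) (APMem? a r k (suc (toℕ i)))))

  Bounded : ∀ {n} → Subset n → Set
  Bounded {n} S = ∃ λ a → a < suc (suc n) × ∃ λ r → r < suc (suc n) ×
                  ∃ λ k → k < suc (suc n) × IsAPWith S a r k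

  bound : ∀ {n} (S : Subset n) → IsAP S → Bounded S
  bound {n} S (a , r , zero , r≥1 , rng , mem) =
    0 , s≤s z≤n , 1 , s≤s (s≤s z≤n) , 0 , s≤s z≤n ,
    s≤s z≤n , (λ ()) ,
    λ i → mk⇔ (λ i∈S → absurd (Equivalence.to (mem i) i∈S))
              (λ { (_ , () , _) })
    where
    absurd : ∀ {B : Set} {x} → APMem a r 0 x → B
    absurd (_ , () , _)
  bound {n} S (a , r , suc zero , r≥1 , rng , mem) =
    a , s≤s (m≤n⇒m≤1+n (subst (_≤ n) (+-identityʳ a) (proj₂ (rng (s≤s z≤n))))) ,
    1 , s≤s (s≤s z≤n) , 1 , s≤s (s≤s z≤n) ,
    s≤s z≤n , (λ { (s≤s z≤n) → rng (s≤s z≤n) }) ,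
    λ i → mk⇔ (λ i∈S → conv₁ (Equivalence.to (mem i) i∈S))
              (λ m → Equivalence.from (mem i) (conv₂ m))
    where
    conv₁ : ∀ {x} → APMem a r 1 x → APMem a 1 1 x
    conv₁ (.0 , s≤s z≤n , eq) = 0 , s≤s z≤n , eq
    conv₂ : ∀ {x} → APMem a 1 1 x → APMem a r 1 x
    conv₂ (.0 , s≤s z≤n , eq) = 0 , s≤s z≤n , eq
  bound {n} S (a , r@(suc r') , k@(suc (suc k')) , r≥1 , rng , mem) =
    a , s≤s (m≤n⇒m≤1+n (subst (_≤ n) (+-identityʳ a) (proj₂ (rng (s≤s z≤n))))) ,
    r , s≤s (m≤n⇒m≤1+n r≤n) ,
    k , s≤s (s≤s k'≤n) ,
    r≥1 , rng , mem
    where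
    r≤n : r ≤ n
    r≤n = ≤-trans (m≤m+n r 0) (m+n≤o⇒n≤o a (proj₂ (rng (s≤s (s≤s z≤n)))))
    k'≤n : suc k' ≤ n
    k'≤n = ≤-trans (m≤m*n (suc k') r) (m+n≤o⇒n≤o a (proj₂ (rng {suc k'} (s≤s Data.Nat.Properties.≤-refl))))

IsAP? : ∀ {n} (S : Subset n) → Dec (IsAP S)
IsAP? {n} S with anyUpTo? (λ a → anyUpTo? (λ r → anyUpTo? (λ k → IsAPWith? S a r k) (suc (suc n))) (suc (suc n))) (suc (suc n))
... | yes (a , _ , r , _ , k , _ , p) = yes (a , r , k , p)
... | no ¬b = no λ ap → ¬b (bound S ap)

allSubsets : ∀ n → List (Subset n)
allSubsets zero    = [] ∷ []
allSubsets (suc n) = map (outside ∷_) (allSubsets n) ++ map (inside ∷_) (allSubsets n)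

L-elems : ∀ n → List (Subset n)
L-elems n = filter IsAP? (allSubsets n)

_≟S_ : ∀ {n} → DecidableEquality (Subset n)
_≟S_ = ≡-dec BoolP._≟_

μL : ∀ n → Subset n → Subset n → ℤ
μL n = MoebiusFinPoset.μP (_≟S_ {n}) (_⊆?_ {n}) (L-elems n)

μ-of-L : ℕ → ℤ
μ-of-L n = μL n ⊥ ⊤

SquareDivisible : ℕ → Set
SquareDivisible s = ∃ λ p → p < suc s × Prime p × p * p ∣ s

primeDivisors : ℕ → List ℕ
primeDivisors s = filter (λ p → prime? p ×-dec (p ∣? s)) (upTo (suc s))

negOnePow : ℕ → ℤ
negOnePow zero    = ℤ.1ℤ
negOnePow (suc j) = - negOnePow j

μℕ : ℕ → ℤ
μℕ s with anyUpTo? (λ p → prime? p ×-dec (p * p ∣? s)) (suc s)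
... | yes _ = ℤ.0ℤ
... | no  _ = negOnePow (length (primeDivisors s))

-- Every T ⊆ [n] lies in a smallest arithmetic progression, its hull: it runs from min T to max T with
-- step gcd {t − min T | t ∈ T}. The progressions are exactly the closed sets of this closure operator and
-- ∅ is one of them, so the classical closure (cross-cut) argument gives
-- μ_n(∅, S) = Σ {(−1)^|T| | hull T = S}. With s = n − 1, the hull of T is [n] iff T contains both ends
-- and no prime divisor of s divides all the differences t − 1. Inclusion–exclusion over these primes
-- leaves the single term in which every prime p ∣ s must divide all differences; it equals
-- (−1)^ω(s) if no multiple of rad s lies strictly between 0 and s, i.e. if s is squarefree, and 0
-- otherwise, where s / p is such a multiple for p² ∣ s. This is μ(s).

module Submission where

open import Defs
open import Data.Nat using (ℕ; zero; suc; _≤_; _∸_; s≤s)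
open import Data.Integer using (ℤ; -_; 1ℤ)
open import Data.Product using (_×_; _,_)
open import Relation.Binary.PropositionalEquality using (_≡_; refl; trans)
open import Data.Empty using (⊥-elim)
open import Data.Fin.Subset using (Subset; _⊆_; ⊥; ⊤; outside)
open import Data.List using (List)
open import Data.List.Membership.Propositional using () renaming (_∈_ to _∈ˡ_)
open import Data.List.Membership.Propositional.Properties using (∈-filter⁺)
open import Data.Vec using ([]; _∷_)
open import Function.Base using (_∘_)
open import Function.Bundles using (_⇔_; mk⇔; Equivalence)
open import Relation.Binary.Definitions using (DecidableEquality) renaming (Decidable to Decidable₂)
open import Relation.Binary.Structures using (IsPartialOrder)
open import Relation.Unary using (Decidable)

module Sums where

  open import Data.Bool using (Bool; true; false)
  open import Data.Bool.Properties using () renaming (_≟_ to _≟ᵇ_)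
  open import Data.Fin using (Fin; zero; suc)
  open import Data.Fin.Properties using (all?)
  open import Data.Fin.Subset using (_∈_; inside)
  open import Data.Fin.Subset.Properties using (_⊆?_)
  open import Data.Integer using (0ℤ; _+_; _*_; _-_)
  open import Data.Integer.Properties
  open import Data.Integer.Tactic.RingSolver using (solve-∀)
  open import Data.List using (List; []; _∷_; map; filter; _++_)
  open import Data.List.Membership.Propositional.Properties using (∈-map⁺; ∈-++⁺ˡ; ∈-++⁺ʳ)
  open import Data.List.Relation.Unary.Any using (here; there)
  open import Data.Vec using (Vec; lookup)
  open import Data.Vec.Functional using (removeAt)
  open import Data.Vec.Properties using ([]=⇒lookup; lookup⇒[]=; tabulate∘lookup; tabulate-cong)
  open import Relation.Nullary using (Dec; yes; no; ¬_)
  open import Relation.Nullary.Decidable using (_×-dec_; _→-dec_)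
  open import Relation.Unary using (Pred)
  open import Relation.Binary.PropositionalEquality
  open import Algebra.Properties.CommutativeMonoid.Sum *-1-commutativeMonoid
    using () renaming (sum to ∏; sum-cong-≗ to ∏-cong; sum-remove to ∏-remove; sum-replicate-zero to ∏-ones)
  open ≡-Reasoning

  𝟙 : ∀ {P : Set} → Dec P → ℤ
  𝟙 (yes _) = 1ℤ
  𝟙 (no _)  = 0ℤ

  𝟙-cong : ∀ {P Q : Set} → (P → Q) → (Q → P) → (d : Dec P) (e : Dec Q) → 𝟙 d ≡ 𝟙 e
  𝟙-cong f g (yes p) (yes q) = refl
  𝟙-cong f g (yes p) (no ¬q) = ⊥-elim (¬q (f p))
  𝟙-cong f g (no ¬p) (yes q) = ⊥-elim (¬p (g q))
  𝟙-cong f g (no ¬p) (no ¬q) = refl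

  𝟙-yes : ∀ {P : Set} (d : Dec P) → P → 𝟙 d ≡ 1ℤ
  𝟙-yes (yes _) p = refl
  𝟙-yes (no ¬p) p = ⊥-elim (¬p p)

  𝟙-no : ∀ {P : Set} (d : Dec P) → ¬ P → 𝟙 d ≡ 0ℤ
  𝟙-no (yes p) ¬p = ⊥-elim (¬p p)
  𝟙-no (no _)  ¬p = refl

  𝟙-× : ∀ {P Q : Set} (d : Dec P) (e : Dec Q) → 𝟙 (d ×-dec e) ≡ 𝟙 d * 𝟙 e
  𝟙-× (yes p) (yes q) = refl
  𝟙-× (yes p) (no ¬q) = refl
  𝟙-× (no ¬p) (yes q) = refl
  𝟙-× (no ¬p) (no ¬q) = refl

  𝟙-¬ : ∀ {P : Set} (d : Dec P) (e : Dec (¬ P)) → 𝟙 e ≡ 1ℤ - 𝟙 d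
  𝟙-¬ (yes p) e = 𝟙-no e (λ ¬p → ¬p p)
  𝟙-¬ (no ¬p) e = 𝟙-yes e ¬p

  ∑ : ∀ {A : Set} → List A → (A → ℤ) → ℤ
  ∑ []       f = 0ℤ
  ∑ (x ∷ xs) f = f x + ∑ xs f

  ∑-cong-∈ : ∀ {A : Set} (xs : List A) {f g : A → ℤ} → (∀ x → x ∈ˡ xs → f x ≡ g x) → ∑ xs f ≡ ∑ xs g
  ∑-cong-∈ []       h = refl
  ∑-cong-∈ (x ∷ xs) h = cong₂ _+_ (h x (here refl)) (∑-cong-∈ xs (λ y y∈ → h y (there y∈)))

  ∑-cong : ∀ {A : Set} (xs : List A) {f g : A → ℤ} → (∀ x → f x ≡ g x) → ∑ xs f ≡ ∑ xs g
  ∑-cong xs h = ∑-cong-∈ xs (λ x _ → h x)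

  ∑-zero : ∀ {A : Set} (xs : List A) → ∑ xs (λ _ → 0ℤ) ≡ 0ℤ
  ∑-zero []       = refl
  ∑-zero (x ∷ xs) = trans (+-identityˡ _) (∑-zero xs)

  ∑-+ : ∀ {A : Set} (xs : List A) (f g : A → ℤ) → ∑ xs (λ x → f x + g x) ≡ ∑ xs f + ∑ xs g
  ∑-+ []       f g = refl
  ∑-+ (x ∷ xs) f g = trans (cong (f x + g x +_) (∑-+ xs f g)) (interchange (f x) (g x) _ _)
    where
    interchange : ∀ a b c d → (a + b) + (c + d) ≡ (a + c) + (b + d)
    interchange = solve-∀

  ∑-neg : ∀ {A : Set} (xs : List A) (f : A → ℤ) → ∑ xs (λ x → - f x) ≡ - ∑ xs f
  ∑-neg []       f = refl
  ∑-neg (x ∷ xs) f = trans (cong (- f x +_) (∑-neg xs f)) (sym (neg-distrib-+ (f x) _))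

  ∑-- : ∀ {A : Set} (xs : List A) (f g : A → ℤ) → ∑ xs (λ x → f x - g x) ≡ ∑ xs f - ∑ xs g
  ∑-- xs f g = trans (∑-+ xs f (λ x → - g x)) (cong (∑ xs f +_) (∑-neg xs g))

  ∑-*ˡ : ∀ {A : Set} (xs : List A) (c : ℤ) (f : A → ℤ) → ∑ xs (λ x → c * f x) ≡ c * ∑ xs f
  ∑-*ˡ []       c f = sym (*-zeroʳ c)
  ∑-*ˡ (x ∷ xs) c f = trans (cong (c * f x +_) (∑-*ˡ xs c f)) (sym (*-distribˡ-+ c (f x) _))

  ∑-++ : ∀ {A : Set} (xs ys : List A) (f : A → ℤ) → ∑ (xs ++ ys) f ≡ ∑ xs f + ∑ ys f
  ∑-++ []       ys f = sym (+-identityˡ _)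
  ∑-++ (x ∷ xs) ys f = trans (cong (f x +_) (∑-++ xs ys f)) (sym (+-assoc (f x) _ _))

  ∑-map : ∀ {A B : Set} (xs : List A) (h : A → B) (f : B → ℤ) → ∑ (map h xs) f ≡ ∑ xs (λ x → f (h x))
  ∑-map []       h f = refl
  ∑-map (x ∷ xs) h f = cong (f (h x) +_) (∑-map xs h f)

  ∑-filter : ∀ {A : Set} {P : Pred A _} (P? : Decidable P) (xs : List A) (f : A → ℤ) →
             ∑ (filter P? xs) f ≡ ∑ xs (λ x → 𝟙 (P? x) * f x)
  ∑-filter P? []       f = refl
  ∑-filter P? (x ∷ xs) f with P? x
  ... | yes _ = cong₂ _+_ (sym (*-identityˡ (f x))) (∑-filter P? xs f)
  ... | no  _ = trans (∑-filter P? xs f) (sym (+-identityˡ _))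

  ∑-swap : ∀ {A B : Set} (xs : List A) (ys : List B) (F : A → B → ℤ) →
           ∑ xs (λ x → ∑ ys (F x)) ≡ ∑ ys (λ y → ∑ xs (λ x → F x y))
  ∑-swap []       ys F = sym (∑-zero ys)
  ∑-swap (x ∷ xs) ys F = trans (cong (∑ ys (F x) +_) (∑-swap xs ys F))
                               (sym (∑-+ ys (F x) (λ y → ∑ xs (λ x → F x y))))

  ∑ₛ : ∀ n → (Subset n → ℤ) → ℤ
  ∑ₛ n = ∑ (allSubsets n)

  ∑ₛ-suc : ∀ n (f : Subset (suc n) → ℤ) →
           ∑ₛ (suc n) f ≡ ∑ₛ n (λ T → f (outside ∷ T)) + ∑ₛ n (λ T → f (inside ∷ T))
  ∑ₛ-suc n f = trans (∑-++ (map (outside ∷_) (allSubsets n)) _ f)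
                     (cong₂ _+_ (∑-map (allSubsets n) (outside ∷_) f) (∑-map (allSubsets n) (inside ∷_) f))

  ∈-allSubsets : ∀ n (S : Subset n) → S ∈ˡ allSubsets n
  ∈-allSubsets zero    []          = here refl
  ∈-allSubsets (suc n) (false ∷ S) = ∈-++⁺ˡ (∈-map⁺ (outside ∷_) (∈-allSubsets n S))
  ∈-allSubsets (suc n) (true ∷ S)  = ∈-++⁺ʳ (map (outside ∷_) (allSubsets n)) (∈-map⁺ (inside ∷_) (∈-allSubsets n S))

  weight : ∀ {n} → (Fin n → Bool → ℤ) → Subset n → ℤ
  weight w T = ∏ (λ i → w i (lookup T i))

  ∑ₛ-weight : ∀ n (w : Fin n → Bool → ℤ) → ∑ₛ n (weight w) ≡ ∏ (λ i → w i false + w i true)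
  ∑ₛ-weight zero    w = refl
  ∑ₛ-weight (suc n) w = begin
      ∑ₛ (suc n) (weight w)
    ≡⟨ ∑ₛ-suc n (weight w) ⟩
      ∑ₛ n (λ T → w zero false * weight w′ T) + ∑ₛ n (λ T → w zero true * weight w′ T)
    ≡⟨ cong₂ _+_ (∑-*ˡ (allSubsets n) (w zero false) (weight w′)) (∑-*ˡ (allSubsets n) (w zero true) (weight w′)) ⟩
      w zero false * ∑ₛ n (weight w′) + w zero true * ∑ₛ n (weight w′)
    ≡⟨ sym (*-distribʳ-+ (∑ₛ n (weight w′)) (w zero false) (w zero true)) ⟩
      (w zero false + w zero true) * ∑ₛ n (weight w′)
    ≡⟨ cong ((w zero false + w zero true) *_) (∑ₛ-weight n w′) ⟩
      ∏ (λ i → w i false + w i true) ∎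
    where
    w′ : Fin n → Bool → ℤ
    w′ i = w (suc i)

  ∏-zero : ∀ {n} (f : Fin n → ℤ) (i : Fin n) → f i ≡ 0ℤ → ∏ f ≡ 0ℤ
  ∏-zero {suc n} f i fi≡0 = trans (∏-remove {i = i} f) (trans (cong (_* ∏ (removeAt f i)) fi≡0) (*-zeroˡ (∏ (removeAt f i))))

  ∏-one : ∀ {n} (f : Fin n → ℤ) → (∀ i → f i ≡ 1ℤ) → ∏ f ≡ 1ℤ
  ∏-one {n} f h = trans (∏-cong h) (∏-ones n)

  ∏-* : ∀ {n} (f g : Fin n → ℤ) → ∏ f * ∏ g ≡ ∏ (λ i → f i * g i)
  ∏-* {zero}  f g = refl
  ∏-* {suc n} f g = trans (interchange (f zero) (g zero) _ _) (cong (f zero * g zero *_) (∏-* (f ∘suc) (g ∘suc)))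
    where
    interchange : ∀ a b c d → (a * c) * (b * d) ≡ (a * b) * (c * d)
    interchange = solve-∀
    _∘suc : (Fin (suc n) → ℤ) → Fin n → ℤ
    h ∘suc = λ i → h (suc i)

  𝟙-∀ : ∀ {n} {P : Fin n → Set} (P? : ∀ i → Dec (P i)) → 𝟙 (all? P?) ≡ ∏ (λ i → 𝟙 (P? i))
  𝟙-∀ {zero}  P? = refl
  𝟙-∀ {suc n} {P} P? = begin
      𝟙 (all? P?)
    ≡⟨ 𝟙-cong split join (all? P?) (P? zero ×-dec all? (λ i → P? (suc i))) ⟩
      𝟙 (P? zero ×-dec all? (λ i → P? (suc i)))
    ≡⟨ 𝟙-× (P? zero) _ ⟩
      𝟙 (P? zero) * 𝟙 (all? (λ i → P? (suc i)))
    ≡⟨ cong (𝟙 (P? zero) *_) (𝟙-∀ (λ i → P? (suc i))) ⟩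
      ∏ (λ i → 𝟙 (P? i)) ∎
    where
    split : (∀ i → P i) → P zero × (∀ i → P (suc i))
    split h = h zero , (λ i → h (suc i))
    join : P zero × (∀ i → P (suc i)) → ∀ i → P i
    join (p , h) zero    = p
    join (p , h) (suc i) = h i

  𝟙-weight : ∀ {n} {R : Set} {Q : Fin n → Bool → Set} (Q? : ∀ i b → Dec (Q i b)) (T : Subset n) (d : Dec R) →
             (R → ∀ i → Q i (lookup T i)) → ((∀ i → Q i (lookup T i)) → R) →
             𝟙 d ≡ weight (λ i b → 𝟙 (Q? i b)) T
  𝟙-weight Q? T d to from = trans (𝟙-cong to from d (all? (λ i → Q? i (lookup T i)))) (𝟙-∀ (λ i → Q? i (lookup T i)))

  lookup-injective : ∀ {n} {A : Set} (xs ys : Vec A n) → (∀ i → lookup xs i ≡ lookup ys i) → xs ≡ ys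
  lookup-injective xs ys h = trans (sym (tabulate∘lookup xs)) (trans (tabulate-cong h) (tabulate∘lookup ys))

  ∑ₛ-δ : ∀ n (c : Subset n) (F : Subset n → ℤ) → ∑ₛ n (λ z → 𝟙 (z ≟S c) * F z) ≡ F c
  ∑ₛ-δ n c F = begin
      ∑ₛ n (λ z → 𝟙 (z ≟S c) * F z)
    ≡⟨ ∑-cong (allSubsets n) (λ z → δ-* z (z ≟S c)) ⟩
      ∑ₛ n (λ z → F c * 𝟙 (z ≟S c))
    ≡⟨ ∑-*ˡ (allSubsets n) (F c) _ ⟩
      F c * ∑ₛ n (λ z → 𝟙 (z ≟S c))
    ≡⟨ cong (F c *_) (trans (∑-cong (allSubsets n) 𝟙-≟) (∑ₛ-weight n (λ i b → 𝟙 (b ≟ᵇ lookup c i)))) ⟩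
      F c * ∏ (λ i → 𝟙 (false ≟ᵇ lookup c i) + 𝟙 (true ≟ᵇ lookup c i))
    ≡⟨ cong (F c *_) (∏-one _ one-hit) ⟩
      F c * 1ℤ
    ≡⟨ *-identityʳ (F c) ⟩
      F c ∎
    where
    δ-* : ∀ z (d : Dec (z ≡ c)) → 𝟙 d * F z ≡ F c * 𝟙 d
    δ-* z (yes refl) = *-comm 1ℤ (F z)
    δ-* z (no _)     = sym (*-zeroʳ (F c))
    𝟙-≟ : ∀ z → 𝟙 (z ≟S c) ≡ weight (λ i b → 𝟙 (b ≟ᵇ lookup c i)) z
    𝟙-≟ z = 𝟙-weight (λ i b → b ≟ᵇ lookup c i) z (z ≟S c) (λ { refl i → refl }) (lookup-injective z c)
    one-hit : ∀ i → 𝟙 (false ≟ᵇ lookup c i) + 𝟙 (true ≟ᵇ lookup c i) ≡ 1ℤ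
    one-hit i with lookup c i
    ... | true  = refl
    ... | false = refl

  signᵇ : Bool → ℤ
  signᵇ true  = - 1ℤ
  signᵇ false = 1ℤ

  sign : ∀ {n} → Subset n → ℤ
  sign = weight (λ _ → signᵇ)

  ∑ₛ-sign-⊆≡0 : ∀ n (S : Subset n) (i : Fin n) → i ∈ S → ∑ₛ n (λ T → sign T * 𝟙 (T ⊆? S)) ≡ 0ℤ
  ∑ₛ-sign-⊆≡0 n S i i∈S = begin
      ∑ₛ n (λ T → sign T * 𝟙 (T ⊆? S))
    ≡⟨ ∑-cong (allSubsets n) (λ T → trans (cong (sign T *_) (𝟙-⊆ T))
                                          (∏-* (λ j → signᵇ (lookup T j)) (λ j → 𝟙 (Q? j (lookup T j))))) ⟩
      ∑ₛ n (weight (λ j b → signᵇ b * 𝟙 (Q? j b)))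
    ≡⟨ ∑ₛ-weight n (λ j b → signᵇ b * 𝟙 (Q? j b)) ⟩
      ∏ (λ j → 1ℤ * 𝟙 (Q? j false) + - 1ℤ * 𝟙 (Q? j true))
    ≡⟨ ∏-zero _ i cancels ⟩
      0ℤ ∎
    where
    Q : Fin n → Bool → Set
    Q j b = b ≡ true → lookup S j ≡ true
    Q? : ∀ j b → Dec (Q j b)
    Q? j b = (b ≟ᵇ true) →-dec (lookup S j ≟ᵇ true)
    𝟙-⊆ : ∀ T → 𝟙 (T ⊆? S) ≡ weight (λ j b → 𝟙 (Q? j b)) T
    𝟙-⊆ T = 𝟙-weight Q? T (T ⊆? S)
              (λ T⊆S j T[j] → []=⇒lookup (T⊆S (lookup⇒[]= j T T[j])))
              (λ h {j} j∈T → lookup⇒[]= j S (h j ([]=⇒lookup j∈T)))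
    cancels : 1ℤ * 𝟙 (Q? i false) + - 1ℤ * 𝟙 (Q? i true) ≡ 0ℤ
    cancels rewrite 𝟙-yes (Q? i false) (λ ()) | 𝟙-yes (Q? i true) (λ _ → []=⇒lookup i∈S) = refl

module FilterLength where

  open import Data.List using ([]; _∷_; filter; length)
  open import Data.List.Membership.Propositional using (_∈_)
  open import Data.List.Relation.Unary.Any using (here; there)
  open import Data.Nat using (_<_; z≤n)
  open import Data.Nat.Properties using (m≤n⇒m≤1+n)
  open import Relation.Nullary using (yes; no; ¬_)

  module _ {B : Set} {P Q : B → Set} (P? : Decidable P) (Q? : Decidable Q) (P⇒Q : ∀ x → P x → Q x) where

    length-filter-mono : (xs : List B) → length (filter P? xs) ≤ length (filter Q? xs)
    length-filter-mono []       = z≤n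
    length-filter-mono (x ∷ xs) with P? x | Q? x
    ... | yes _  | yes _  = s≤s (length-filter-mono xs)
    ... | yes px | no ¬qx = ⊥-elim (¬qx (P⇒Q x px))
    ... | no _   | yes _  = m≤n⇒m≤1+n (length-filter-mono xs)
    ... | no _   | no _   = length-filter-mono xs

    length-filter-strict : (xs : List B) → ∀ {y} → y ∈ xs → Q y → ¬ P y →
                           length (filter P? xs) < length (filter Q? xs)
    length-filter-strict (x ∷ xs) (here refl) qy ¬py with P? x | Q? x
    ... | yes px | _      = ⊥-elim (¬py px)
    ... | no _   | yes _  = s≤s (length-filter-mono xs)
    ... | no _   | no ¬qy = ⊥-elim (¬qy qy)
    length-filter-strict (x ∷ xs) (there y∈xs) qy ¬py with P? x | Q? x
    ... | yes _  | yes _  = s≤s (length-filter-strict xs y∈xs qy ¬py)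
    ... | yes px | no ¬qx = ⊥-elim (¬qx (P⇒Q x px))
    ... | no _   | yes _  = m≤n⇒m≤1+n (length-filter-strict xs y∈xs qy ¬py)
    ... | no _   | no _   = length-filter-strict xs y∈xs qy ¬py

module MoebiusCharacterisation
  {A : Set} (_≟A_ : DecidableEquality A) {_≼_ : A → A → Set} (_≼?_ : Decidable₂ _≼_)
  (≼-isPartialOrder : IsPartialOrder _≡_ _≼_) (elems : List A) where

  open import Data.Integer using (_+_)
  open import Data.Integer.Properties using (neg-involutive)
  open import Data.List using ([]; _∷_; map; filter; length)
  open import Data.List.Membership.Propositional using (_∈_)
  open import Data.List.Membership.Propositional.Properties using (∈-filter⁻)
  open import Data.List.Properties using (length-filter)
  open import Data.Nat using (_<_)
  open import Data.Nat.Properties using (≤-pred; <-≤-trans)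
  open import Data.Product using (proj₁)
  open import Relation.Nullary using (yes; no; ¬_)
  open import Relation.Nullary.Decidable using (_×-dec_; ¬?)
  open import Relation.Binary.PropositionalEquality using (sym; cong; module ≡-Reasoning)
  open IsPartialOrder ≼-isPartialOrder using (antisym) renaming (refl to ≼-refl; trans to ≼-trans)
  open MoebiusFinPoset _≟A_ _≼?_ elems
  open Sums using (∑; ∑-cong-∈)
  open FilterLength using (length-filter-strict)

  _≺_ : A → A → Set
  z ≺ y = z ≼ y × ¬ z ≡ y

  _≺?_ : Decidable₂ _≺_
  z ≺? y = (z ≼? y) ×-dec ¬? (z ≟A y)

  ≺-≼-trans : ∀ {w z y} → w ≺ z → z ≼ y → w ≺ y
  ≺-≼-trans (w≼z , w≢z) z≼y = ≼-trans w≼z z≼y , λ { refl → w≢z (antisym w≼z z≼y) }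

  height : A → ℕ
  height y = length (filter (_≺? y) elems)

  height-mono : ∀ {z y} → z ∈ elems → z ≺ y → height z < height y
  height-mono {z} {y} z∈ z≺y =
    length-filter-strict (_≺? z) (_≺? y) (λ w w≺z → ≺-≼-trans w≺z (proj₁ z≺y)) elems z∈ z≺y (λ (_ , z≢z) → z≢z refl)

  height<length : ∀ {y} → y ∈ elems → height y < length elems
  height<length {y} y∈ =
    <-≤-trans (length-filter-strict (_≺? y) (_≼? y) (λ _ → proj₁) elems y∈ ≼-refl (λ (_ , y≢y) → y≢y refl))
              (length-filter (_≼? y) elems)

  sumℤ-map : ∀ (xs : List A) (f : A → ℤ) → sumℤ (map f xs) ≡ ∑ xs f
  sumℤ-map []       f = refl
  sumℤ-map (x ∷ xs) f = cong (f x +_) (sumℤ-map xs f)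

  module _ (x : A) (g : A → ℤ) (g[x]≡1 : g x ≡ 1ℤ)
           (g-recursion : ∀ y → y ∈ elems → ¬ x ≡ y → ∑ (below x y) g ≡ - g y) where

    μ-fuel-agrees : ∀ f y → y ∈ elems → height y < f → μ-fuel f x y ≡ g y
    μ-fuel-agrees (suc f) y y∈ h<f with x ≟A y
    ... | yes refl = sym g[x]≡1
    ... | no x≢y   = begin
        - sumℤ (map (μ-fuel f x) (below x y))  ≡⟨ cong -_ (sumℤ-map (below x y) (μ-fuel f x)) ⟩
        - ∑ (below x y) (μ-fuel f x)           ≡⟨ cong -_ (∑-cong-∈ (below x y) agrees-below) ⟩
        - ∑ (below x y) g                      ≡⟨ cong -_ (g-recursion y y∈ x≢y) ⟩
        - - g y                                ≡⟨ neg-involutive (g y) ⟩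
        g y                                    ∎
      where
      open ≡-Reasoning
      agrees-below : ∀ z → z ∈ below x y → μ-fuel f x z ≡ g z
      agrees-below z z∈ with ∈-filter⁻ (λ z → (x ≼? z) ×-dec ((z ≼? y) ×-dec ¬? (z ≟A y))) {xs = elems} z∈
      ... | z∈elems , _ , z≺y = μ-fuel-agrees f z z∈elems (<-≤-trans (height-mono z∈elems z≺y) (≤-pred h<f))

    μP-unique : ∀ y → y ∈ elems → μP x y ≡ g y
    μP-unique y y∈ = μ-fuel-agrees (length elems) y y∈ (height<length y∈)

module ClosureMoebius
  (n : ℕ) {Closed : Subset n → Set} (Closed? : Decidable Closed)
  (cl : Subset n → Subset n) (cl-closed : ∀ T → Closed (cl T)) (⊆-cl : ∀ T → T ⊆ cl T)
  (cl-least : ∀ T S → Closed S → T ⊆ S → cl T ⊆ S) (⊥-closed : Closed ⊥) where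

  open import Data.Integer using (0ℤ; _*_; _-_)
  open import Data.Integer.Properties using (*-identityˡ; *-comm; +-identityˡ)
  open import Data.Integer.Tactic.RingSolver using (solve-∀)
  open import Data.Fin.Subset.Properties using (_⊆?_; ⊆-isPartialOrder; ⊆-refl; ⊆-trans; ⊆-antisym; ⊥⊆; nonempty?; Empty-unique)
  open import Data.List using (filter)
  open import Data.List.Membership.Propositional.Properties using (∈-filter⁻)
  open import Data.Product using (proj₂)
  open import Data.Vec using (lookup)
  open import Data.Vec.Properties using (lookup-replicate)
  open import Relation.Nullary using (yes; no; ¬_)
  open import Relation.Nullary.Decidable using (_×-dec_; ¬?)
  open import Relation.Binary.PropositionalEquality using (sym; cong; cong₂; subst; module ≡-Reasoning)
  open Sums
  open ≡-Reasoning

  closedSets : List (Subset n)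
  closedSets = filter Closed? (allSubsets n)

  open MoebiusFinPoset _≟S_ _⊆?_ closedSets using (μP; below)
  open MoebiusCharacterisation _≟S_ _⊆?_ (⊆-isPartialOrder n) closedSets using (μP-unique)

  generatorSum : Subset n → ℤ
  generatorSum S = ∑ₛ n (λ T → sign T * 𝟙 (cl T ≟S S))

  cl≡⊥⇔ : ∀ T → cl T ≡ ⊥ ⇔ T ≡ ⊥
  cl≡⊥⇔ T = mk⇔ (λ cl[T]≡⊥ → ⊆-antisym (subst (T ⊆_) cl[T]≡⊥ (⊆-cl T)) ⊥⊆)
                (λ { refl → ⊆-antisym (cl-least ⊥ ⊥ ⊥-closed ⊆-refl) ⊥⊆ })

  sign-⊥ : sign (⊥ {n}) ≡ 1ℤ
  sign-⊥ = ∏-one (λ i → signᵇ (lookup (⊥ {n}) i)) (λ i → cong signᵇ (lookup-replicate i outside))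

  generatorSum-⊥ : generatorSum ⊥ ≡ 1ℤ
  generatorSum-⊥ = begin
      ∑ₛ n (λ T → sign T * 𝟙 (cl T ≟S ⊥))
    ≡⟨ ∑-cong (allSubsets n) (λ T → trans (cong (sign T *_)
                                                (𝟙-cong (to (cl≡⊥⇔ T)) (from (cl≡⊥⇔ T)) (cl T ≟S ⊥) (T ≟S ⊥)))
                                          (*-comm (sign T) _)) ⟩
      ∑ₛ n (λ T → 𝟙 (T ≟S ⊥) * sign T)
    ≡⟨ ∑ₛ-δ n ⊥ sign ⟩
      sign (⊥ {n})
    ≡⟨ sign-⊥ ⟩
      1ℤ ∎
    where open Equivalence

  closedBelow : Subset n → Subset n → ℤ
  closedBelow S z = 𝟙 (Closed? z) * 𝟙 (z ⊆? S)

  ∑-below : ∀ (g : Subset n → ℤ) S → Closed S →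
            ∑ (below ⊥ S) g ≡ ∑ₛ n (λ z → closedBelow S z * g z) - g S
  ∑-below g S closed-S = begin
      ∑ (below ⊥ S) g
    ≡⟨ ∑-filter strictlyBelow? closedSets g ⟩
      ∑ closedSets (λ z → 𝟙 (strictlyBelow? z) * g z)
    ≡⟨ ∑-filter Closed? (allSubsets n) _ ⟩
      ∑ₛ n (λ z → 𝟙 (Closed? z) * (𝟙 (strictlyBelow? z) * g z))
    ≡⟨ ∑-cong (allSubsets n) remove-top ⟩
      ∑ₛ n (λ z → F z - 𝟙 (z ≟S S) * F z)
    ≡⟨ ∑-- (allSubsets n) F _ ⟩
      ∑ₛ n F - ∑ₛ n (λ z → 𝟙 (z ≟S S) * F z)
    ≡⟨ cong (λ t → ∑ₛ n F - t) (trans (∑ₛ-δ n S F) F[S]≡g[S]) ⟩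
      ∑ₛ n F - g S ∎
    where
    strictlyBelow? : Decidable (λ z → ⊥ ⊆ z × z ⊆ S × ¬ z ≡ S)
    strictlyBelow? z = (⊥ ⊆? z) ×-dec ((z ⊆? S) ×-dec ¬? (z ≟S S))
    F : Subset n → ℤ
    F z = closedBelow S z * g z
    𝟙-strictlyBelow : ∀ z → 𝟙 (strictlyBelow? z) ≡ 𝟙 (z ⊆? S) * (1ℤ - 𝟙 (z ≟S S))
    𝟙-strictlyBelow z = begin
        𝟙 (strictlyBelow? z)
      ≡⟨ 𝟙-× (⊥ ⊆? z) _ ⟩
        𝟙 (⊥ ⊆? z) * 𝟙 ((z ⊆? S) ×-dec ¬? (z ≟S S))
      ≡⟨ cong₂ _*_ (𝟙-yes (⊥ ⊆? z) ⊥⊆) (𝟙-× (z ⊆? S) (¬? (z ≟S S))) ⟩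
        1ℤ * (𝟙 (z ⊆? S) * 𝟙 (¬? (z ≟S S)))
      ≡⟨ trans (*-identityˡ _) (cong (𝟙 (z ⊆? S) *_) (𝟙-¬ (z ≟S S) (¬? (z ≟S S)))) ⟩
        𝟙 (z ⊆? S) * (1ℤ - 𝟙 (z ≟S S)) ∎
    expand : ∀ a b c d → a * (b * (1ℤ - c) * d) ≡ a * b * d - c * (a * b * d)
    expand = solve-∀
    remove-top : ∀ z → 𝟙 (Closed? z) * (𝟙 (strictlyBelow? z) * g z) ≡ F z - 𝟙 (z ≟S S) * F z
    remove-top z = trans (cong (λ t → 𝟙 (Closed? z) * (t * g z)) (𝟙-strictlyBelow z))
                         (expand (𝟙 (Closed? z)) (𝟙 (z ⊆? S)) (𝟙 (z ≟S S)) (g z))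
    F[S]≡g[S] : F S ≡ g S
    F[S]≡g[S] = trans (cong (_* g S) (cong₂ _*_ (𝟙-yes (Closed? S) closed-S) (𝟙-yes (S ⊆? S) ⊆-refl)))
                      (*-identityˡ (g S))

  -- Each T is counted once, at z = cl T, and cl T ⊆ S ⇔ T ⊆ S for closed S.
  ∑-closed-generatorSum : ∀ S → Closed S →
    ∑ₛ n (λ z → closedBelow S z * generatorSum z) ≡ ∑ₛ n (λ T → sign T * 𝟙 (T ⊆? S))
  ∑-closed-generatorSum S closed-S = begin
      ∑ₛ n (λ z → closedBelow S z * generatorSum z)
    ≡⟨ ∑-cong (allSubsets n) (λ z → sym (∑-*ˡ (allSubsets n) (H z) (λ T → sign T * 𝟙 (cl T ≟S z)))) ⟩
      ∑ₛ n (λ z → ∑ₛ n (λ T → H z * (sign T * 𝟙 (cl T ≟S z))))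
    ≡⟨ ∑-swap (allSubsets n) (allSubsets n) _ ⟩
      ∑ₛ n (λ T → ∑ₛ n (λ z → H z * (sign T * 𝟙 (cl T ≟S z))))
    ≡⟨ ∑-cong (allSubsets n) (λ T → trans (∑-cong (allSubsets n) (rearrange T)) (∑-*ˡ (allSubsets n) (sign T) _)) ⟩
      ∑ₛ n (λ T → sign T * ∑ₛ n (λ z → 𝟙 (z ≟S cl T) * H z))
    ≡⟨ ∑-cong (allSubsets n) (λ T → cong (sign T *_) (trans (∑ₛ-δ n (cl T) H) (H-cl T))) ⟩
      ∑ₛ n (λ T → sign T * 𝟙 (T ⊆? S)) ∎
    where
    H : Subset n → ℤ
    H = closedBelow S
    reorder : ∀ a b c d → a * b * (c * d) ≡ c * (d * (a * b))
    reorder = solve-∀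
    rearrange : ∀ T z → H z * (sign T * 𝟙 (cl T ≟S z)) ≡ sign T * (𝟙 (z ≟S cl T) * H z)
    rearrange T z = trans (reorder (𝟙 (Closed? z)) (𝟙 (z ⊆? S)) (sign T) (𝟙 (cl T ≟S z)))
                          (cong (λ t → sign T * (t * H z)) (𝟙-cong sym sym (cl T ≟S z) (z ≟S cl T)))
    H-cl : ∀ T → H (cl T) ≡ 𝟙 (T ⊆? S)
    H-cl T = trans (cong (_* 𝟙 (cl T ⊆? S)) (𝟙-yes (Closed? (cl T)) (cl-closed T)))
             (trans (*-identityˡ _) (𝟙-cong (⊆-trans (⊆-cl T)) (cl-least T S closed-S) (cl T ⊆? S) (T ⊆? S)))

  generatorSum-recursion : ∀ S → S ∈ˡ closedSets → ¬ ⊥ ≡ S → ∑ (below ⊥ S) generatorSum ≡ - generatorSum S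
  generatorSum-recursion S S∈ ⊥≢S with proj₂ (∈-filter⁻ Closed? {xs = allSubsets n} S∈) | nonempty? S
  ... | closed-S | no empty-S      = ⊥-elim (⊥≢S (sym (Empty-unique empty-S)))
  ... | closed-S | yes (i , i∈S) = begin
      ∑ (below ⊥ S) generatorSum
    ≡⟨ ∑-below generatorSum S closed-S ⟩
      ∑ₛ n (λ z → closedBelow S z * generatorSum z) - generatorSum S
    ≡⟨ cong (_- generatorSum S) (trans (∑-closed-generatorSum S closed-S) (∑ₛ-sign-⊆≡0 n S i i∈S)) ⟩
      0ℤ - generatorSum S
    ≡⟨ +-identityˡ _ ⟩
      - generatorSum S ∎

  μP-⊥≡generatorSum : ∀ S → S ∈ˡ closedSets → μP ⊥ S ≡ generatorSum S
  μP-⊥≡generatorSum = μP-unique ⊥ generatorSum generatorSum-⊥ generatorSum-recursion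

module APClosure where

  open import Data.Bool using (Bool; true; false; if_then_else_)
  open import Data.Fin using (Fin; zero; suc; toℕ)
  open import Data.Fin.Properties using (toℕ<n)
  open import Data.Fin.Subset using (_∈_; Nonempty)
  open import Data.Fin.Subset.Properties using (nonempty?; ∉⊥; ∈⊤)
  open import Data.Nat using (_+_; _*_; _<_; _≤?_; z≤n)
  open import Data.Nat.Properties
  open import Data.Nat.Divisibility using (_∣_; divides; _∣?_; _∣0; 0∣⇒≡0; ∣-trans; n∣m*n)
  open import Data.Nat.GCD using (gcd; gcd[m,n]∣m; gcd[m,n]∣n; gcd-greatest)
  open import Data.Product using (∃; proj₁; proj₂)
  open import Data.Vec using (_∷_; here; there; tabulate)
  open import Data.Vec.Properties using (lookup∘tabulate; []=⇒lookup; lookup⇒[]=)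
  open import Relation.Nullary using (Dec; yes; no; does)
  open import Relation.Nullary.Decidable using (_×-dec_; dec-true)
  open import Relation.Binary.PropositionalEquality using (sym; cong; cong₂; subst; subst₂; module ≡-Reasoning)

  nonemptyᵇ : ∀ {n} → Subset n → Bool
  nonemptyᵇ []          = false
  nonemptyᵇ (true ∷ T)  = true
  nonemptyᵇ (false ∷ T) = nonemptyᵇ T

  ∈⇒nonemptyᵇ : ∀ {n} {T : Subset n} {i} → i ∈ T → nonemptyᵇ T ≡ true
  ∈⇒nonemptyᵇ {T = true ∷ T}  _         = refl
  ∈⇒nonemptyᵇ {T = false ∷ T} (there p) = ∈⇒nonemptyᵇ p

  nonemptyᵇ⇒Nonempty : ∀ {n} (T : Subset n) → nonemptyᵇ T ≡ true → Nonempty T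
  nonemptyᵇ⇒Nonempty (true ∷ T)  _  = zero , here
  nonemptyᵇ⇒Nonempty (false ∷ T) eq = let (i , i∈T) = nonemptyᵇ⇒Nonempty T eq in suc i , there i∈T

  -- minₛ ⊥ and maxₛ ⊥ are both 0, which is why InHull also demands Nonempty T.
  minₛ : ∀ {n} → Subset n → ℕ
  minₛ []          = 0
  minₛ (true ∷ T)  = 0
  minₛ (false ∷ T) = suc (minₛ T)

  maxₛ : ∀ {n} → Subset n → ℕ
  maxₛ []      = 0
  maxₛ (_ ∷ T) = if nonemptyᵇ T then suc (maxₛ T) else 0

  minₛ≤ : ∀ {n} {T : Subset n} {i} → i ∈ T → minₛ T ≤ toℕ i
  minₛ≤ {T = true ∷ T}  _         = z≤n
  minₛ≤ {T = false ∷ T} (there p) = s≤s (minₛ≤ p)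

  ≤maxₛ : ∀ {n} {T : Subset n} {i} → i ∈ T → toℕ i ≤ maxₛ T
  ≤maxₛ {T = _ ∷ T} here      = z≤n
  ≤maxₛ {T = _ ∷ T} (there p) rewrite ∈⇒nonemptyᵇ p = s≤s (≤maxₛ p)

  minₛ-∈ : ∀ {n} (T : Subset n) → Nonempty T → ∃ λ j → j ∈ T × toℕ j ≡ minₛ T
  minₛ-∈ (true ∷ T)  _                 = zero , here , refl
  minₛ-∈ (false ∷ T) (suc i , there p) = let (j , j∈T , eq) = minₛ-∈ T (i , p) in suc j , there j∈T , cong suc eq

  maxₛ-∈ : ∀ {n} (T : Subset n) → Nonempty T → ∃ λ j → j ∈ T × toℕ j ≡ maxₛ T
  maxₛ-∈ (b ∷ T) nonempty with nonemptyᵇ T in eq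
  ... | true = let (j , j∈T , eq′) = maxₛ-∈ T (nonemptyᵇ⇒Nonempty T eq) in suc j , there j∈T , cong suc eq′
  maxₛ-∈ (b ∷ T) (zero , here) | false = zero , here , refl
  maxₛ-∈ (b ∷ T) (suc i , there p) | false with () ← trans (sym eq) (∈⇒nonemptyᵇ p)

  gcdₛ : ∀ {n} → (Fin n → ℕ) → Subset n → ℕ
  gcdₛ w []          = 0
  gcdₛ w (true ∷ T)  = gcd (w zero) (gcdₛ (λ i → w (suc i)) T)
  gcdₛ w (false ∷ T) = gcdₛ (λ i → w (suc i)) T

  gcdₛ-∣ : ∀ {n} (w : Fin n → ℕ) (T : Subset n) {i} → i ∈ T → gcdₛ w T ∣ w i
  gcdₛ-∣ w (true ∷ T)  here      = gcd[m,n]∣m (w zero) (gcdₛ (λ i → w (suc i)) T)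
  gcdₛ-∣ w (true ∷ T)  (there p) = ∣-trans (gcd[m,n]∣n (w zero) _) (gcdₛ-∣ (λ i → w (suc i)) T p)
  gcdₛ-∣ w (false ∷ T) (there p) = gcdₛ-∣ (λ i → w (suc i)) T p

  ∣-gcdₛ : ∀ {n} (w : Fin n → ℕ) (T : Subset n) {d} → (∀ i → i ∈ T → d ∣ w i) → d ∣ gcdₛ w T
  ∣-gcdₛ w []          h = _ ∣0
  ∣-gcdₛ w (true ∷ T)  h = gcd-greatest (h zero here) (∣-gcdₛ (λ i → w (suc i)) T (λ i p → h (suc i) (there p)))
  ∣-gcdₛ w (false ∷ T) h = ∣-gcdₛ (λ i → w (suc i)) T (λ i p → h (suc i) (there p))

  stride : ∀ {n} → Subset n → ℕ
  stride T = gcdₛ (λ j → toℕ j ∸ minₛ T) T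

  InHull : ∀ {n} → Subset n → Fin n → Set
  InHull T i = Nonempty T × minₛ T ≤ toℕ i × toℕ i ≤ maxₛ T × stride T ∣ toℕ i ∸ minₛ T

  InHull? : ∀ {n} (T : Subset n) (i : Fin n) → Dec (InHull T i)
  InHull? T i = nonempty? T ×-dec ((minₛ T ≤? toℕ i) ×-dec ((toℕ i ≤? maxₛ T) ×-dec (stride T ∣? (toℕ i ∸ minₛ T))))

  apHull : ∀ {n} → Subset n → Subset n
  apHull T = tabulate (λ i → does (InHull? T i))

  ∈-apHull⁻ : ∀ {n} (T : Subset n) {i} → i ∈ apHull T → InHull T i
  ∈-apHull⁻ T {i} i∈ = witness (InHull? T i) (trans (sym (lookup∘tabulate _ i)) ([]=⇒lookup i∈))
    where
    witness : ∀ {P : Set} (d : Dec P) → does d ≡ true → P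
    witness (yes p) _ = p

  ∈-apHull⁺ : ∀ {n} (T : Subset n) {i} → InHull T i → i ∈ apHull T
  ∈-apHull⁺ T {i} h = lookup⇒[]= i (apHull T) (trans (lookup∘tabulate _ i) (dec-true (InHull? T i) h))

  ⊆-apHull : ∀ {n} (T : Subset n) → T ⊆ apHull T
  ⊆-apHull T p = ∈-apHull⁺ T ((_ , p) , minₛ≤ p , ≤maxₛ p , gcdₛ-∣ _ T p)

  module _ {n : ℕ} (T : Subset n) (nonempty-T : Nonempty T) where
    private
      m M : ℕ
      m = minₛ T
      M = maxₛ T
      last : ∃ λ j → j ∈ T × toℕ j ≡ M
      last = maxₛ-∈ T nonempty-T
      toℕ-last : toℕ (proj₁ last) ≡ M
      toℕ-last = proj₂ (proj₂ last)
      m≤M : m ≤ M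
      m≤M = subst (m ≤_) toℕ-last (minₛ≤ (proj₁ (proj₂ last)))
      M<n : M < n
      M<n = subst (_< n) toℕ-last (toℕ<n (proj₁ last))
      stride∣M∸m : stride T ∣ M ∸ m
      stride∣M∸m = subst (λ x → stride T ∣ x ∸ m) toℕ-last (gcdₛ-∣ _ T (proj₁ (proj₂ last)))

    apHull-singleton : stride T ≡ 0 → IsAPWith (apHull T) (suc m) 1 1
    apHull-singleton stride≡0 = s≤s z≤n , in-range , λ i → mk⇔ (to i) (from i)
      where
      ∸m≡0 : ∀ {x} → m ≤ x → stride T ∣ x ∸ m → x ≡ m
      ∸m≡0 {x} m≤x ∣x∸m = trans (sym (m+[n∸m]≡n m≤x))
                                 (trans (cong (m +_) (0∣⇒≡0 (subst (_∣ x ∸ m) stride≡0 ∣x∸m))) (+-identityʳ m))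
      M≡m : M ≡ m
      M≡m = ∸m≡0 m≤M stride∣M∸m
      in-range : APInRange n (suc m) 1 1
      in-range {zero}  _ = s≤s z≤n , subst (_≤ n) (cong suc (sym (+-identityʳ m))) (subst (_< n) M≡m M<n)
      in-range {suc j} (s≤s ())
      to : ∀ i → i ∈ apHull T → APMem (suc m) 1 1 (suc (toℕ i))
      to i i∈ with ∈-apHull⁻ T i∈
      ... | _ , m≤i , _ , ∣i∸m = 0 , s≤s z≤n , cong suc (trans (∸m≡0 m≤i ∣i∸m) (sym (+-identityʳ m)))
      from : ∀ i → APMem (suc m) 1 1 (suc (toℕ i)) → i ∈ apHull T
      from i (zero , _ , eq) = ∈-apHull⁺ T (nonempty-T , ≤-reflexive (sym i≡m) , subst (_≤ M) (sym i≡m) (≤-reflexive (sym M≡m)) ,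
                                             subst (stride T ∣_) (sym (trans (cong (_∸ m) i≡m) (n∸n≡0 m))) (stride T ∣0))
        where
        i≡m : toℕ i ≡ m
        i≡m = trans (suc-injective eq) (+-identityʳ m)
      from i (suc j , s≤s () , _)

    apHull-progression : ∀ g → stride T ≡ suc g → IsAP (apHull T)
    apHull-progression g′ stride≡g with subst (_∣ M ∸ m) stride≡g stride∣M∸m
    ... | divides q M∸m≡q*g = suc m , g , suc q , s≤s z≤n , in-range , λ i → mk⇔ (to i) (from i)
      where
      g : ℕ
      g = suc g′
      term≤M : ∀ {j} → j ≤ q → m + j * g ≤ M
      term≤M j≤q = ≤-trans (+-monoʳ-≤ m (≤-trans (*-monoˡ-≤ g j≤q) (≤-reflexive (sym M∸m≡q*g))))
                           (≤-reflexive (m+[n∸m]≡n m≤M))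
      in-range : APInRange n (suc m) g (suc q)
      in-range (s≤s j≤q) = s≤s z≤n , ≤-trans (s≤s (term≤M j≤q)) M<n
      to : ∀ i → i ∈ apHull T → APMem (suc m) g (suc q) (suc (toℕ i))
      to i i∈ with ∈-apHull⁻ T i∈
      ... | _ , m≤i , i≤M , ∣i∸m with subst (_∣ toℕ i ∸ m) stride≡g ∣i∸m
      ... | divides c i∸m≡c*g = c , s≤s c≤q , cong suc (trans (sym (m+[n∸m]≡n m≤i)) (cong (m +_) i∸m≡c*g))
        where
        c≤q : c ≤ q
        c≤q = *-cancelʳ-≤ c q g (≤-trans (≤-reflexive (sym i∸m≡c*g)) (≤-trans (∸-monoˡ-≤ m i≤M) (≤-reflexive M∸m≡q*g)))
      from : ∀ i → APMem (suc m) g (suc q) (suc (toℕ i)) → i ∈ apHull T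
      from i (j , s≤s j≤q , eq) = ∈-apHull⁺ T (nonempty-T , subst (m ≤_) (sym i≡) (m≤m+n m (j * g)) ,
                                               subst (_≤ M) (sym i≡) (term≤M j≤q) ,
                                               subst (_∣ toℕ i ∸ m) (sym stride≡g) (subst (g ∣_) (sym i∸m≡j*g) (n∣m*n j)))
        where
        i≡ : toℕ i ≡ m + j * g
        i≡ = suc-injective eq
        i∸m≡j*g : toℕ i ∸ m ≡ j * g
        i∸m≡j*g = trans (cong (_∸ m) i≡) (m+n∸m≡n m (j * g))

  apHull-isAP : ∀ {n} (T : Subset n) → IsAP (apHull T)
  apHull-isAP T = by-cases (nonempty? T)
    where
    by-cases : Dec (Nonempty T) → IsAP (apHull T)
    by-cases (no empty-T) = 0 , 1 , 0 , s≤s z≤n , (λ ()) ,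
      λ i → mk⇔ (λ i∈ → ⊥-elim (empty-T (proj₁ (∈-apHull⁻ T i∈)))) (λ { (_ , () , _) })
    by-cases (yes nonempty-T) = by-stride (stride T) refl
      where
      by-stride : ∀ g → stride T ≡ g → IsAP (apHull T)
      by-stride zero    eq = suc (minₛ T) , 1 , 1 , apHull-singleton T nonempty-T eq
      by-stride (suc g) eq = apHull-progression T nonempty-T g eq

  apHull-least : ∀ {n} (T S : Subset n) → IsAP S → T ⊆ S → apHull T ⊆ S
  apHull-least {n} T S (a , suc r′ , k , _ , _ , mem) T⊆S {i} i∈ with ∈-apHull⁻ T i∈
  ... | nonempty-T , m≤i , i≤M , stride∣ = from (mem i) (j₁ + c , ≤-trans (s≤s j₁+c≤j₂) j₂<k , i≡term)
    where
    open Equivalence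
    r m M : ℕ
    r = suc r′
    m = minₛ T
    M = maxₛ T
    first : ∃ λ j → j ∈ T × toℕ j ≡ m
    first = minₛ-∈ T nonempty-T
    last : ∃ λ j → j ∈ T × toℕ j ≡ M
    last = maxₛ-∈ T nonempty-T
    index : ∀ {t} → t ∈ T → APMem a r k (suc (toℕ t))
    index t∈T = to (mem _) (T⊆S t∈T)
    j₁ j₂ : ℕ
    j₁ = proj₁ (index (proj₁ (proj₂ first)))
    j₂ = proj₁ (index (proj₁ (proj₂ last)))
    j₂<k : j₂ < k
    j₂<k = proj₁ (proj₂ (index (proj₁ (proj₂ last))))
    suc-m≡ : suc m ≡ a + j₁ * r
    suc-m≡ = trans (cong suc (sym (proj₂ (proj₂ first)))) (proj₂ (proj₂ (index (proj₁ (proj₂ first)))))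
    suc-M≡ : suc M ≡ a + j₂ * r
    suc-M≡ = trans (cong suc (sym (proj₂ (proj₂ last)))) (proj₂ (proj₂ (index (proj₁ (proj₂ last)))))
    r∣t∸m : ∀ t → t ∈ T → r ∣ toℕ t ∸ m
    r∣t∸m t t∈T with index t∈T
    ... | j , _ , suc-t≡ = divides (j ∸ j₁) (begin
          toℕ t ∸ m                    ≡⟨ cong₂ _∸_ suc-t≡ suc-m≡ ⟩
          (a + j * r) ∸ (a + j₁ * r)   ≡⟨ [m+n]∸[m+o]≡n∸o a (j * r) (j₁ * r) ⟩
          j * r ∸ j₁ * r               ≡⟨ *-distribʳ-∸ r j j₁ ⟨
          (j ∸ j₁) * r                 ∎)
      where open ≡-Reasoning
    r∣i∸m : r ∣ toℕ i ∸ m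
    r∣i∸m = ∣-trans (∣-gcdₛ _ T r∣t∸m) stride∣
    c : ℕ
    c = _∣_.quotient r∣i∸m
    i≡term : suc (toℕ i) ≡ a + (j₁ + c) * r
    i≡term = begin
        suc (toℕ i)              ≡⟨ cong suc (m+[n∸m]≡n m≤i) ⟨
        suc m + (toℕ i ∸ m)      ≡⟨ cong₂ _+_ suc-m≡ (_∣_.equality r∣i∸m) ⟩
        a + j₁ * r + c * r       ≡⟨ +-assoc a (j₁ * r) (c * r) ⟩
        a + (j₁ * r + c * r)     ≡⟨ cong (a +_) (*-distribʳ-+ r j₁ c) ⟨
        a + (j₁ + c) * r         ∎
      where open ≡-Reasoning
    j₁+c≤j₂ : j₁ + c ≤ j₂
    j₁+c≤j₂ = *-cancelʳ-≤ (j₁ + c) j₂ r (+-cancelˡ-≤ a _ _ (subst₂ _≤_ i≡term suc-M≡ (s≤s i≤M)))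

  ⊥-isAP : ∀ {n} → IsAP (⊥ {n})
  ⊥-isAP = 0 , 1 , 0 , s≤s z≤n , (λ ()) , λ i → mk⇔ (λ i∈⊥ → ⊥-elim (∉⊥ i∈⊥)) (λ { (_ , () , _) })

  ⊤-isAP : ∀ n → IsAP (⊤ {n})
  ⊤-isAP n = 1 , 1 , n , s≤s z≤n , in-range ,
    λ i → mk⇔ (λ _ → toℕ i , toℕ<n i , cong suc (sym (*-identityʳ (toℕ i)))) (λ _ → ∈⊤)
    where
    in-range : APInRange n 1 1 n
    in-range {j} j<n = s≤s z≤n , subst (λ x → suc x ≤ n) (sym (*-identityʳ j)) j<n

module PrimeDivisors where

  open import Data.Nat as ℕ using (_*_; _<_; z≤n; nonTrivial⇒n>1)
  open import Data.Nat.Properties using (*-comm; *-assoc; m<m*n)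
  open import Data.Nat.Divisibility using (_∣_; divides; 1∣_; m∣m*n; n∣m*n; ∣-trans; *-monoˡ-∣)
  open import Data.Nat.ListAction using (product)
  open import Data.Nat.Primality using (Prime; prime⇒nonTrivial; prime⇒irreducible; euclidsLemma)
  open import Data.Nat.Primality.Factorisation using (factorise; PrimeFactorisation)
  open import Data.List using ([]; _∷_)
  open import Data.List.Membership.Propositional using (_∈_; _∉_)
  open import Data.List.Relation.Unary.All using (All; []; _∷_)
  open import Data.List.Relation.Unary.Any using (here; there)
  open import Data.Product using (∃)
  open import Data.Sum using (inj₁; inj₂)
  open import Induction.WellFounded using (Acc; acc)
  open import Relation.Nullary using (¬_)
  open import Relation.Binary.PropositionalEquality using (sym; cong; subst)

  prime≥2 : ∀ {p} → Prime p → 2 ≤ p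
  prime≥2 {p} p-prime = nonTrivial⇒n>1 p {{prime⇒nonTrivial p-prime}}

  prime∣prime⇒≡ : ∀ {q p} → Prime q → Prime p → q ∣ p → q ≡ p
  prime∣prime⇒≡ q-prime p-prime q∣p with prime⇒irreducible p-prime q∣p
  ... | inj₂ q≡p = q≡p
  ... | inj₁ refl with s≤s () ← prime≥2 q-prime

  ∃-prime∣ : ∀ s → 2 ≤ s → ∃ λ p → Prime p × p ∣ s
  ∃-prime∣ s@(suc _) (s≤s 1≤s′) = head-factor (PrimeFactorisation.factors f) (PrimeFactorisation.isFactorisation f)
                                          (PrimeFactorisation.factorsPrime f)
    where
    f : PrimeFactorisation s
    f = factorise s
    head-factor : ∀ ps → s ≡ product ps → All Prime ps → ∃ λ p → Prime p × p ∣ s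
    head-factor []       s≡1 _ with () ← subst (1 ≤_) (cong ℕ.pred s≡1) 1≤s′
    head-factor (p ∷ ps) s≡  (p-prime ∷ _) = p , p-prime , subst (p ∣_) (sym s≡) (m∣m*n (product ps))

  squarefree⇒∣ : ∀ {s} → Acc _<_ s → 1 ≤ s → (∀ p → Prime p → ¬ p * p ∣ s) →
                 ∀ x → (∀ p → Prime p → p ∣ s → p ∣ x) → s ∣ x
  squarefree⇒∣ {suc zero} _ _ _ x _ = 1∣ x
  squarefree⇒∣ {s@(suc (suc _))} (acc smaller) _ squarefree x prime∣x with ∃-prime∣ s (s≤s (s≤s z≤n))
  ... | p , p-prime , divides s′ s≡s′*p with prime∣x p p-prime (divides s′ s≡s′*p)
  ... | divides x′ x≡x′*p = subst (_∣ x) (sym s≡s′*p) (subst (s′ * p ∣_) (sym x≡x′*p) (*-monoˡ-∣ p s′∣x′))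
    where
    positive-cofactor : ∀ t → s ≡ t * p → 1 ≤ t
    positive-cofactor (suc _) _ = s≤s z≤n
    s′≥1 : 1 ≤ s′
    s′≥1 = positive-cofactor s′ s≡s′*p
    s′<s : s′ < s
    s′<s = subst (s′ <_) (sym s≡s′*p) (m<m*n s′ p {{ℕ.>-nonZero s′≥1}} (prime≥2 p-prime))
    s′∣s : s′ ∣ s
    s′∣s = divides p (trans s≡s′*p (*-comm s′ p))
    s′∣x′ : s′ ∣ x′
    s′∣x′ = squarefree⇒∣ (smaller s′<s) s′≥1 (λ q q-prime q²∣s′ → squarefree q q-prime (∣-trans q²∣s′ s′∣s))
                         x′ prime∣x′
      where
      prime∣x′ : ∀ q → Prime q → q ∣ s′ → q ∣ x′
      prime∣x′ q q-prime q∣s′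
        with euclidsLemma x′ p q-prime (subst (q ∣_) x≡x′*p (prime∣x q q-prime (∣-trans q∣s′ s′∣s)))
      ... | inj₁ q∣x′ = q∣x′
      ... | inj₂ q∣p with refl ← prime∣prime⇒≡ q-prime p-prime q∣p =
        ⊥-elim (squarefree q q-prime (subst (q * q ∣_) (sym s≡s′*p) (*-monoˡ-∣ q q∣s′)))

  PrimeDivisor : ℕ → ℕ → Set
  PrimeDivisor s q = Prime q × q ∣ s

  CommonMultipleBelow : ℕ → List ℕ → Set
  CommonMultipleBelow s L = ∃ λ x → (1 ≤ x × x < s) × All (_∣ x) L

  cofactor-divisible : ∀ {s x p} (L : List ℕ) → All (PrimeDivisor s) L → s ≡ x * p → Prime p →
                       (∀ {q} → q ∈ L → q ≡ p → q ∣ x) → All (_∣ x) L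
  cofactor-divisible []       _                      _      _       _ = []
  cofactor-divisible {x = x} {p} (q ∷ L) ((q-prime , q∣s) ∷ rest) s≡x*p p-prime p∣x
    with euclidsLemma x p q-prime (subst (q ∣_) s≡x*p q∣s)
  ... | inj₁ q∣x = q∣x ∷ cofactor-divisible L rest s≡x*p p-prime (λ q∈ → p∣x (there q∈))
  ... | inj₂ q∣p = p∣x (here refl) (prime∣prime⇒≡ q-prime p-prime q∣p)
                   ∷ cofactor-divisible L rest s≡x*p p-prime (λ q∈ → p∣x (there q∈))

  cofactor-below : ∀ {s x p} → 1 ≤ s → Prime p → s ≡ x * p → 1 ≤ x × x < s
  cofactor-below {x = zero}  (s≤s z≤n) _ ()
  cofactor-below {x = suc x} {p} _ p-prime s≡x*p = s≤s z≤n , subst (suc x <_) (sym s≡x*p) (m<m*n (suc x) p (prime≥2 p-prime))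

  omitted-prime⇒commonMultipleBelow : ∀ {s p} (L : List ℕ) → 1 ≤ s → All (PrimeDivisor s) L → Prime p → p ∣ s → p ∉ L →
                                      CommonMultipleBelow s L
  omitted-prime⇒commonMultipleBelow L s≥1 L-prime p-prime (divides x s≡x*p) p∉L =
    x , cofactor-below s≥1 p-prime s≡x*p ,
    cofactor-divisible L L-prime s≡x*p p-prime (λ { q∈L refl → ⊥-elim (p∉L q∈L) })

  square∣⇒commonMultipleBelow : ∀ {s p} (L : List ℕ) → 1 ≤ s → All (PrimeDivisor s) L → Prime p → p * p ∣ s →
                                CommonMultipleBelow s L
  square∣⇒commonMultipleBelow {s} {p} L s≥1 L-prime p-prime (divides k s≡k*p*p) =
    k * p , cofactor-below s≥1 p-prime s≡kp*p , cofactor-divisible L L-prime s≡kp*p p-prime (λ { _ refl → n∣m*n k })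
    where
    s≡kp*p : s ≡ k * p * p
    s≡kp*p = trans s≡k*p*p (sym (*-assoc k p p))

module SpanningSets (t : ℕ) where

  open import Data.Bool using (Bool; true; false)
  open import Data.Bool.Properties using () renaming (_≟_ to _≟ᵇ_)
  open import Data.Fin using (Fin; zero; suc; toℕ; fromℕ; fromℕ<; inject₁)
  open import Data.Fin.Properties using (all?; toℕ<n; toℕ-injective; toℕ-fromℕ; toℕ-fromℕ<; toℕ-inject₁)
  open import Data.Fin.Subset using (_∈_; Nonempty)
  open import Data.Fin.Subset.Properties using (_∈?_; ⊆-antisym; ∈⊤; ⊆⊤)
  open import Data.Integer using (0ℤ; _+_; _*_; _-_)
  open import Data.Integer.Properties using (*-zeroʳ; *-identityˡ; *-identityʳ)
  open import Data.Integer.Tactic.RingSolver using (solve-∀)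
  open import Data.List using ([]; _∷_; _++_; length; upTo)
  open import Data.List.Membership.Propositional using () renaming (_∉_ to _∉ˡ_)
  open import Data.List.Membership.Propositional.Properties using (∈-++⁻; ∈-++⁺ˡ; ∈-++⁺ʳ; ∈-filter⁻; ∈-upTo⁺)
  open import Data.List.Relation.Unary.All as All using (All; []; _∷_)
  open import Data.List.Relation.Unary.All.Properties using (++⁺)
  open import Data.List.Relation.Unary.Any using (here; there)
  open import Data.List.Relation.Unary.Unique.Propositional using (Unique)
  import Data.List.Relation.Unary.Unique.Propositional.Properties as Unique
  open import Data.List.Relation.Unary.AllPairs using ([]; _∷_)
  open import Data.Nat as ℕ using (z≤n; _≟_)
  import Data.Nat.Properties as ℕₚ
  open import Data.Nat.Divisibility using (_∣_; _∣?_; _∣0; 1∣_; ∣-trans; ∣⇒≤; 0∣⇒≡0; ∣1⇒≡1)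
  open import Data.Nat.Primality using (prime?; prime⇒nonZero)
  open import Data.Nat.Induction using (<-wellFounded)
  open import Data.List.Properties using (++-identityʳ)
  open import Data.Product using (proj₁; proj₂)
  open import Data.Sum using (_⊎_; inj₁; inj₂)
  open import Data.Vec using (lookup)
  open import Data.Vec.Properties using ([]=⇒lookup; lookup⇒[]=)
  open import Relation.Nullary using (Dec; yes; no; ¬_)
  open import Relation.Nullary.Decidable using (_×-dec_; _→-dec_; _⊎-dec_; ¬?)
  open import Relation.Binary.PropositionalEquality using (sym; cong; cong₂; subst; module ≡-Reasoning)
  open import Algebra.Properties.CommutativeMonoid.Sum Data.Integer.Properties.*-1-commutativeMonoid
    using () renaming (sum to ∏; sum-cong-≗ to ∏-cong; sum-init-last to ∏-init-last)
  open Sums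
  open APClosure
  open PrimeDivisors
  open ≡-Reasoning

  -- Positions i : Fin n are 0-based, so toℕ i = 0 and toℕ i = s are the ends 1 and n of [n],
  -- and toℕ i is the difference from the first end.
  s : ℕ
  s = suc t

  n : ℕ
  n = suc s

  IsEnd : ℕ → Set
  IsEnd x = x ≡ 0 ⊎ x ≡ s

  isEnd? : ∀ x → Dec (IsEnd x)
  isEnd? x = (x ≟ 0) ⊎-dec (x ≟ s)

  ContainsEnds : Subset n → Set
  ContainsEnds T = ∀ i → IsEnd (toℕ i) → i ∈ T

  MultiplesOf : ℕ → Subset n → Set
  MultiplesOf p T = ∀ i → i ∈ T → p ∣ toℕ i

  CommonMultiple : List ℕ → ℕ → Set
  CommonMultiple Q x = All (_∣ x) Q

  commonMultiple? : ∀ Q x → Dec (CommonMultiple Q x)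
  commonMultiple? Q x = All.all? (_∣? x) Q

  CommonMultiplesOf : List ℕ → Subset n → Set
  CommonMultiplesOf Q T = ∀ i → i ∈ T → CommonMultiple Q (toℕ i)

  Admissible : List ℕ → List ℕ → Subset n → Set
  Admissible L Q T = ContainsEnds T × All (λ p → ¬ MultiplesOf p T) L × CommonMultiplesOf Q T

  admissible? : ∀ L Q T → Dec (Admissible L Q T)
  admissible? L Q T =
    all? (λ i → isEnd? (toℕ i) →-dec (i ∈? T)) ×-dec
    (All.all? (λ p → ¬? (all? (λ i → (i ∈? T) →-dec (p ∣? toℕ i)))) L ×-dec
     all? (λ i → (i ∈? T) →-dec commonMultiple? Q (toℕ i)))

  Φ : List ℕ → List ℕ → ℤ
  Φ L Q = ∑ₛ n (λ T → sign T * 𝟙 (admissible? L Q T))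

  𝟙-admissible-∷ : ∀ p L Q T → 𝟙 (admissible? (p ∷ L) Q T) ≡ 𝟙 (admissible? L Q T) - 𝟙 (admissible? L (p ∷ Q) T)
  𝟙-admissible-∷ p L Q T = begin
      𝟙 (admissible? (p ∷ L) Q T)
    ≡⟨ 𝟙-cong drop-p add-p (admissible? (p ∷ L) Q T) (X ×-dec ¬? p∣T?) ⟩
      𝟙 (X ×-dec ¬? p∣T?)
    ≡⟨ trans (𝟙-× X (¬? p∣T?)) (cong (𝟙 X *_) (𝟙-¬ p∣T? (¬? p∣T?))) ⟩
      𝟙 X * (1ℤ - 𝟙 p∣T?)
    ≡⟨ distrib (𝟙 X) (𝟙 p∣T?) ⟩
      𝟙 X - 𝟙 X * 𝟙 p∣T?
    ≡⟨ cong (λ u → 𝟙 X - u) (sym (trans (𝟙-cong split-p join-p (admissible? L (p ∷ Q) T) (X ×-dec p∣T?)) (𝟙-× X p∣T?))) ⟩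
      𝟙 X - 𝟙 (admissible? L (p ∷ Q) T) ∎
    where
    X : Dec (Admissible L Q T)
    X = admissible? L Q T
    p∣T? : Dec (MultiplesOf p T)
    p∣T? = all? (λ i → (i ∈? T) →-dec (p ∣? toℕ i))
    distrib : ∀ a b → a * (1ℤ - b) ≡ a - a * b
    distrib = solve-∀
    drop-p : Admissible (p ∷ L) Q T → Admissible L Q T × ¬ MultiplesOf p T
    drop-p (ends , p∤T ∷ L∤T , Q∣T) = (ends , L∤T , Q∣T) , p∤T
    add-p : Admissible L Q T × ¬ MultiplesOf p T → Admissible (p ∷ L) Q T
    add-p ((ends , L∤T , Q∣T) , p∤T) = ends , p∤T ∷ L∤T , Q∣T
    split-p : Admissible L (p ∷ Q) T → Admissible L Q T × MultiplesOf p T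
    split-p (ends , L∤T , pQ∣T) = (ends , L∤T , λ i i∈T → All.tail (pQ∣T i i∈T)) , (λ i i∈T → All.head (pQ∣T i i∈T))
    join-p : Admissible L Q T × MultiplesOf p T → Admissible L (p ∷ Q) T
    join-p ((ends , L∤T , Q∣T) , p∣T) = ends , L∤T , λ i i∈T → p∣T i i∈T ∷ Q∣T i i∈T

  Φ-∷ : ∀ p L Q → Φ (p ∷ L) Q ≡ Φ L Q - Φ L (p ∷ Q)
  Φ-∷ p L Q = trans (∑-cong (allSubsets n) (λ T → trans (cong (sign T *_) (𝟙-admissible-∷ p L Q T)) (distrib (sign T) _ _)))
                    (∑-- (allSubsets n) (λ T → sign T * 𝟙 (admissible? L Q T)) (λ T → sign T * 𝟙 (admissible? L (p ∷ Q) T)))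
    where
    distrib : ∀ a b c → a * (b - c) ≡ a * b - a * c
    distrib = solve-∀

  NoInteriorMultiple : List ℕ → Set
  NoInteriorMultiple Q = ∀ (i : Fin t) → ¬ CommonMultiple Q (suc (toℕ i))

  noInteriorMultiple? : ∀ Q → Dec (NoInteriorMultiple Q)
  noInteriorMultiple? Q = all? (λ i → ¬? (commonMultiple? Q (suc (toℕ i))))

  Coordinate : List ℕ → ℕ → Bool → Set
  Coordinate Q x b = (IsEnd x → b ≡ true) × (b ≡ true → CommonMultiple Q x)

  coordinate? : ∀ Q x b → Dec (Coordinate Q x b)
  coordinate? Q x b = (isEnd? x →-dec (b ≟ᵇ true)) ×-dec ((b ≟ᵇ true) →-dec commonMultiple? Q x)

  coordinateSum : List ℕ → ℕ → ℤ
  coordinateSum Q x = signᵇ false * 𝟙 (coordinate? Q x false) + signᵇ true * 𝟙 (coordinate? Q x true)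

  𝟙-inside : ∀ Q x → 𝟙 (coordinate? Q x true) ≡ 𝟙 (commonMultiple? Q x)
  𝟙-inside Q x = 𝟙-cong (λ c → proj₂ c refl) (λ m → (λ _ → refl) , (λ _ → m)) (coordinate? Q x true) (commonMultiple? Q x)

  coordinateSum-end : ∀ Q x → IsEnd x → CommonMultiple Q x → coordinateSum Q x ≡ - 1ℤ
  coordinateSum-end Q x end Q∣x =
    cong₂ (λ a b → 1ℤ * a + - 1ℤ * b) (𝟙-no (coordinate? Q x false) (λ c → false≢true (proj₁ c end)))
                                       (trans (𝟙-inside Q x) (𝟙-yes (commonMultiple? Q x) Q∣x))
    where
    false≢true : ¬ false ≡ true
    false≢true ()

  coordinateSum-interior : ∀ Q (i : Fin t) → coordinateSum Q (suc (toℕ i)) ≡ 𝟙 (¬? (commonMultiple? Q (suc (toℕ i))))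
  coordinateSum-interior Q i = begin
      1ℤ * 𝟙 (coordinate? Q x false) + - 1ℤ * 𝟙 (coordinate? Q x true)
    ≡⟨ cong₂ (λ a b → 1ℤ * a + - 1ℤ * b) (𝟙-yes (coordinate? Q x false) ((λ end → ⊥-elim (interior end)) , λ ()))
                                          (𝟙-inside Q x) ⟩
      1ℤ * 1ℤ + - 1ℤ * 𝟙 (commonMultiple? Q x)
    ≡⟨ simplify (𝟙 (commonMultiple? Q x)) ⟩
      1ℤ - 𝟙 (commonMultiple? Q x)
    ≡⟨ 𝟙-¬ (commonMultiple? Q x) (¬? (commonMultiple? Q x)) ⟨
      𝟙 (¬? (commonMultiple? Q x)) ∎
    where
    x : ℕ
    x = suc (toℕ i)
    simplify : ∀ a → 1ℤ * 1ℤ + - 1ℤ * a ≡ 1ℤ - a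
    simplify = solve-∀
    interior : ¬ IsEnd x
    interior (inj₁ ())
    interior (inj₂ x≡s) = ℕₚ.<-irrefl (ℕₚ.suc-injective x≡s) (toℕ<n i)

  Φ-[] : ∀ Q → All (_∣ s) Q → Φ [] Q ≡ 𝟙 (noInteriorMultiple? Q)
  Φ-[] Q Q∣s = begin
      ∑ₛ n (λ T → sign T * 𝟙 (admissible? [] Q T))
    ≡⟨ ∑-cong (allSubsets n) (λ T → trans (cong (sign T *_) (𝟙-admissible-[] T))
                                          (∏-* (λ i → signᵇ (lookup T i)) (λ i → 𝟙 (coordinate? Q (toℕ i) (lookup T i))))) ⟩
      ∑ₛ n (weight (λ i b → signᵇ b * 𝟙 (coordinate? Q (toℕ i) b)))
    ≡⟨ ∑ₛ-weight n (λ i b → signᵇ b * 𝟙 (coordinate? Q (toℕ i) b)) ⟩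
      coordinateSum Q 0 * ∏ (λ (i : Fin s) → coordinateSum Q (suc (toℕ i)))
    ≡⟨ cong (coordinateSum Q 0 *_) (∏-init-last (λ (i : Fin s) → coordinateSum Q (suc (toℕ i)))) ⟩
      coordinateSum Q 0 * (∏ (λ (i : Fin t) → coordinateSum Q (suc (toℕ (inject₁ i)))) * coordinateSum Q (suc (toℕ (fromℕ t))))
    ≡⟨ cong₂ (λ a b → a * b) (coordinateSum-end Q 0 (inj₁ refl) (All.tabulate (λ {q} _ → q ∣0)))
                             (cong₂ _*_ (∏-cong interior) last-end) ⟩
      - 1ℤ * (∏ (λ (i : Fin t) → 𝟙 (¬? (commonMultiple? Q (suc (toℕ i))))) * - 1ℤ)
    ≡⟨ signs-cancel _ ⟩
      ∏ (λ (i : Fin t) → 𝟙 (¬? (commonMultiple? Q (suc (toℕ i)))))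
    ≡⟨ 𝟙-∀ (λ i → ¬? (commonMultiple? Q (suc (toℕ i)))) ⟨
      𝟙 (noInteriorMultiple? Q) ∎
    where
    𝟙-admissible-[] : ∀ T → 𝟙 (admissible? [] Q T) ≡ weight (λ i b → 𝟙 (coordinate? Q (toℕ i) b)) T
    𝟙-admissible-[] T = 𝟙-weight (λ i b → coordinate? Q (toℕ i) b) T (admissible? [] Q T)
      (λ (ends , _ , Q∣T) i → (λ end → []=⇒lookup (ends i end)) , (λ T[i] → Q∣T i (lookup⇒[]= i T T[i])))
      (λ h → (λ i end → lookup⇒[]= i T (proj₁ (h i) end)) , [] , (λ i i∈T → proj₂ (h i) ([]=⇒lookup i∈T)))
    interior : ∀ i → coordinateSum Q (suc (toℕ (inject₁ i))) ≡ 𝟙 (¬? (commonMultiple? Q (suc (toℕ i))))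
    interior i rewrite toℕ-inject₁ i = coordinateSum-interior Q i
    last-end : coordinateSum Q (suc (toℕ (fromℕ t))) ≡ - 1ℤ
    last-end rewrite toℕ-fromℕ t = coordinateSum-end Q s (inj₂ refl) Q∣s
    signs-cancel : ∀ a → - 1ℤ * (a * - 1ℤ) ≡ a
    signs-cancel = solve-∀

  commonMultipleBelow⇒𝟙≡0 : ∀ L → CommonMultipleBelow s L → 𝟙 (noInteriorMultiple? L) ≡ 0ℤ
  commonMultipleBelow⇒𝟙≡0 L (suc y , (_ , s≤s y<t) , L∣x) =
    𝟙-no (noInteriorMultiple? L) (λ none → none (fromℕ< y<t) (subst (λ z → CommonMultiple L (suc z)) (sym (toℕ-fromℕ< y<t)) L∣x))

  𝟙-noInteriorMultiple-cong : ∀ L₁ L₂ → (∀ {x} → x ∈ˡ L₁ → x ∈ˡ L₂) → (∀ {x} → x ∈ˡ L₂ → x ∈ˡ L₁) →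
                              𝟙 (noInteriorMultiple? L₁) ≡ 𝟙 (noInteriorMultiple? L₂)
  𝟙-noInteriorMultiple-cong L₁ L₂ ⊆₁₂ ⊆₂₁ =
    𝟙-cong (λ none i L₂∣ → none i (restrict ⊆₁₂ L₂∣)) (λ none i L₁∣ → none i (restrict ⊆₂₁ L₁∣))
           (noInteriorMultiple? L₁) (noInteriorMultiple? L₂)
    where
    restrict : ∀ {M N x} → (∀ {q} → q ∈ˡ M → q ∈ˡ N) → CommonMultiple N x → CommonMultiple M x
    restrict M⊆N N∣x = All.tabulate (λ q∈M → All.lookup N∣x (M⊆N q∈M))

  Sieve : List ℕ → List ℕ → Set
  Sieve L Q = Unique L × (∀ {x} → x ∈ˡ L → x ∉ˡ Q) × All (PrimeDivisor s) L × All (PrimeDivisor s) Q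

  -- A prime p of L that is not in Q leaves the interior common multiple s / p of L ++ Q, so
  -- the term Φ L Q vanishes and only Φ L (p ∷ Q) survives.
  Φ-value : ∀ L Q → Sieve L Q → Φ L Q ≡ negOnePow (length L) * 𝟙 (noInteriorMultiple? (L ++ Q))
  Φ-value [] Q (_ , _ , _ , Q-primes) = trans (Φ-[] Q (All.map proj₂ Q-primes)) (sym (*-identityˡ _))
  Φ-value (p ∷ L) Q (p∉L ∷ L-unique , disjoint , p-prime∣s ∷ L-primes , Q-primes) = begin
      Φ (p ∷ L) Q
    ≡⟨ Φ-∷ p L Q ⟩
      Φ L Q - Φ L (p ∷ Q)
    ≡⟨ cong₂ _-_ (Φ-value L Q sieve-Q) (Φ-value L (p ∷ Q) sieve-pQ) ⟩
      ε * 𝟙 (noInteriorMultiple? (L ++ Q)) - ε * 𝟙 (noInteriorMultiple? (L ++ p ∷ Q))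
    ≡⟨ cong₂ (λ a b → ε * a - ε * b) vanishes (𝟙-noInteriorMultiple-cong (L ++ p ∷ Q) (p ∷ L ++ Q) move-p unmove-p) ⟩
      ε * 0ℤ - ε * 𝟙 (noInteriorMultiple? (p ∷ L ++ Q))
    ≡⟨ simplify ε _ ⟩
      - ε * 𝟙 (noInteriorMultiple? (p ∷ L ++ Q)) ∎
    where
    ε : ℤ
    ε = negOnePow (length L)
    simplify : ∀ a c → a * 0ℤ - a * c ≡ - a * c
    simplify = solve-∀
    sieve-Q : Sieve L Q
    sieve-Q = L-unique , (λ x∈L → disjoint (there x∈L)) , L-primes , Q-primes
    sieve-pQ : Sieve L (p ∷ Q)
    sieve-pQ = L-unique , disjoint′ , L-primes , p-prime∣s ∷ Q-primes
      where
      disjoint′ : ∀ {x} → x ∈ˡ L → x ∉ˡ p ∷ Q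
      disjoint′ x∈L (here x≡p)  = All.lookup p∉L x∈L (sym x≡p)
      disjoint′ x∈L (there x∈Q) = disjoint (there x∈L) x∈Q
    p∉L++Q : p ∉ˡ L ++ Q
    p∉L++Q p∈ with ∈-++⁻ L p∈
    ... | inj₁ p∈L = All.lookup p∉L p∈L refl
    ... | inj₂ p∈Q = disjoint (here refl) p∈Q
    vanishes : 𝟙 (noInteriorMultiple? (L ++ Q)) ≡ 0ℤ
    vanishes = commonMultipleBelow⇒𝟙≡0 (L ++ Q)
      (omitted-prime⇒commonMultipleBelow (L ++ Q) (s≤s z≤n) (++⁺ L-primes Q-primes) (proj₁ p-prime∣s) (proj₂ p-prime∣s) p∉L++Q)
    move-p : ∀ {x} → x ∈ˡ L ++ p ∷ Q → x ∈ˡ p ∷ L ++ Q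
    move-p x∈ with ∈-++⁻ L x∈
    ... | inj₁ x∈L         = there (∈-++⁺ˡ x∈L)
    ... | inj₂ (here x≡p)  = here x≡p
    ... | inj₂ (there x∈Q) = there (∈-++⁺ʳ L x∈Q)
    unmove-p : ∀ {x} → x ∈ˡ p ∷ L ++ Q → x ∈ˡ L ++ p ∷ Q
    unmove-p (here x≡p) = ∈-++⁺ʳ L (here x≡p)
    unmove-p (there x∈) with ∈-++⁻ L x∈
    ... | inj₁ x∈L = ∈-++⁺ˡ x∈L
    ... | inj₂ x∈Q = ∈-++⁺ʳ L (there x∈Q)

  primes : List ℕ
  primes = primeDivisors s

  ∈primes⁻ : ∀ {p} → p ∈ˡ primes → PrimeDivisor s p
  ∈primes⁻ = proj₂ ∘ ∈-filter⁻ (λ p → prime? p ×-dec (p ∣? s)) {xs = upTo (suc s)}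

  ∈primes⁺ : ∀ {p} → PrimeDivisor s p → p ∈ˡ primes
  ∈primes⁺ (p-prime , p∣s) = ∈-filter⁺ (λ p → prime? p ×-dec (p ∣? s)) (∈-upTo⁺ (s≤s (∣⇒≤ p∣s))) (p-prime , p∣s)

  primes-unique : Unique primes
  primes-unique = Unique.filter⁺ (λ p → prime? p ×-dec (p ∣? s)) (Unique.upTo⁺ (suc s))

  module _ (T : Subset n) (minₛ≡0 : minₛ T ≡ 0) where

    stride∣ : ∀ {j} → j ∈ T → stride T ∣ toℕ j
    stride∣ {j} j∈T = subst (λ m → stride T ∣ toℕ j ∸ m) minₛ≡0 (gcdₛ-∣ _ T j∈T)

    ∣stride : ∀ {p} → MultiplesOf p T → p ∣ stride T
    ∣stride p∣T = ∣-gcdₛ _ T (λ j j∈T → subst (λ m → _ ∣ toℕ j ∸ m) (sym minₛ≡0) (p∣T j j∈T))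

  apHull≡⊤⇒admissible : ∀ T → apHull T ≡ ⊤ → Admissible primes [] T
  apHull≡⊤⇒admissible T hull≡⊤ = ends , All.tabulate avoids , (λ _ _ → [])
    where
    inHull : ∀ i → InHull T i
    inHull i = ∈-apHull⁻ T (subst (i ∈_) (sym hull≡⊤) ∈⊤)
    nonempty-T : Nonempty T
    nonempty-T = proj₁ (inHull zero)
    minₛ≡0 : minₛ T ≡ 0
    minₛ≡0 = ℕₚ.n≤0⇒n≡0 (proj₁ (proj₂ (inHull zero)))
    ends : ContainsEnds T
    ends i (inj₁ i≡0) with minₛ-∈ T nonempty-T
    ... | j , j∈T , j≡min = subst (_∈ T) (toℕ-injective (trans j≡min (trans minₛ≡0 (sym i≡0)))) j∈T
    ends i (inj₂ i≡s) with maxₛ-∈ T nonempty-T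
    ... | j , j∈T , j≡max = subst (_∈ T) (toℕ-injective (trans j≡max (trans max≡s (sym i≡s)))) j∈T
      where
      max≡s : maxₛ T ≡ s
      max≡s = ℕₚ.≤-antisym (subst (_≤ s) j≡max (ℕₚ.≤-pred (toℕ<n j)))
                          (subst (_≤ maxₛ T) i≡s (proj₁ (proj₂ (proj₂ (inHull i)))))
    avoids : ∀ {p} → p ∈ˡ primes → ¬ MultiplesOf p T
    avoids p∈ p∣T with ∣1⇒≡1 (∣-trans (∣stride T minₛ≡0 p∣T) stride∣1)
      where
      stride∣1 : stride T ∣ 1
      stride∣1 = subst (λ m → stride T ∣ 1 ∸ m) minₛ≡0 (proj₂ (proj₂ (proj₂ (inHull (suc zero)))))
    ... | refl with s≤s () ← prime≥2 (proj₁ (∈primes⁻ p∈))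

  admissible⇒apHull≡⊤ : ∀ T → Admissible primes [] T → apHull T ≡ ⊤
  admissible⇒apHull≡⊤ T (ends , avoids , _) = ⊆-antisym ⊆⊤ (λ {i} _ → ∈-apHull⁺ T (inHull i))
    where
    0∈T : zero ∈ T
    0∈T = ends zero (inj₁ refl)
    s∈T : fromℕ s ∈ T
    s∈T = ends (fromℕ s) (inj₂ (toℕ-fromℕ s))
    minₛ≡0 : minₛ T ≡ 0
    minₛ≡0 = ℕₚ.n≤0⇒n≡0 (minₛ≤ 0∈T)
    s≤max : s ≤ maxₛ T
    s≤max = subst (_≤ maxₛ T) (toℕ-fromℕ s) (≤maxₛ s∈T)
    stride∣s : stride T ∣ s
    stride∣s = subst (stride T ∣_) (toℕ-fromℕ s) (stride∣ T minₛ≡0 s∈T)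
    stride≡1 : ∀ g → stride T ≡ g → stride T ≡ 1
    stride≡1 zero          stride≡0 with () ← 0∣⇒≡0 (subst (_∣ s) stride≡0 stride∣s)
    stride≡1 (suc zero)    eq = eq
    stride≡1 (suc (suc g)) stride≡g with ∃-prime∣ (suc (suc g)) (s≤s (s≤s z≤n))
    ... | p , p-prime , p∣g = ⊥-elim (All.lookup avoids (∈primes⁺ (p-prime , ∣-trans p∣stride stride∣s))
                                                         (λ j j∈T → ∣-trans p∣stride (stride∣ T minₛ≡0 j∈T)))
      where
      p∣stride : p ∣ stride T
      p∣stride = subst (p ∣_) (sym stride≡g) p∣g
    inHull : ∀ i → InHull T i
    inHull i = (zero , 0∈T) , subst (_≤ toℕ i) (sym minₛ≡0) z≤n , ℕₚ.≤-trans (ℕₚ.≤-pred (toℕ<n i)) s≤max ,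
               subst (_∣ toℕ i ∸ minₛ T) (sym (stride≡1 (stride T) refl)) (1∣ _)

  ∑-spanning : ∑ₛ n (λ T → sign T * 𝟙 (apHull T ≟S ⊤)) ≡ negOnePow (length primes) * 𝟙 (noInteriorMultiple? primes)
  ∑-spanning = begin
      ∑ₛ n (λ T → sign T * 𝟙 (apHull T ≟S ⊤))
    ≡⟨ ∑-cong (allSubsets n) (λ T → cong (sign T *_)
         (𝟙-cong (apHull≡⊤⇒admissible T) (admissible⇒apHull≡⊤ T) (apHull T ≟S ⊤) (admissible? primes [] T))) ⟩
      Φ primes []
    ≡⟨ Φ-value primes [] (primes-unique , (λ _ ()) , All.tabulate ∈primes⁻ , []) ⟩
      negOnePow (length primes) * 𝟙 (noInteriorMultiple? (primes ++ []))
    ≡⟨ cong (λ L → negOnePow (length primes) * 𝟙 (noInteriorMultiple? L)) (++-identityʳ primes) ⟩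
      negOnePow (length primes) * 𝟙 (noInteriorMultiple? primes) ∎

  μℕ-cases : (SquareDivisible s × μℕ s ≡ 0ℤ) ⊎ (¬ SquareDivisible s × μℕ s ≡ negOnePow (length primes))
  μℕ-cases with ℕₚ.anyUpTo? (λ p → prime? p ×-dec (p ℕ.* p ∣? s)) (suc s)
  ... | yes square∣ = inj₁ (square∣ , refl)
  ... | no  squarefree = inj₂ (squarefree , refl)

  ∑-spanning≡μℕ : ∑ₛ n (λ T → sign T * 𝟙 (apHull T ≟S ⊤)) ≡ μℕ s
  ∑-spanning≡μℕ with μℕ-cases
  ... | inj₁ ((p , _ , p-prime , p²∣s) , μℕ≡0) = begin
      ∑ₛ n (λ T → sign T * 𝟙 (apHull T ≟S ⊤))
    ≡⟨ ∑-spanning ⟩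
      negOnePow (length primes) * 𝟙 (noInteriorMultiple? primes)
    ≡⟨ cong (negOnePow (length primes) *_) (commonMultipleBelow⇒𝟙≡0 primes
         (square∣⇒commonMultipleBelow primes (s≤s z≤n) (All.tabulate ∈primes⁻) p-prime p²∣s)) ⟩
      negOnePow (length primes) * 0ℤ
    ≡⟨ trans (*-zeroʳ (negOnePow (length primes))) (sym μℕ≡0) ⟩
      μℕ s ∎
  ... | inj₂ (squarefree , μℕ≡ε) = begin
      ∑ₛ n (λ T → sign T * 𝟙 (apHull T ≟S ⊤))
    ≡⟨ ∑-spanning ⟩
      negOnePow (length primes) * 𝟙 (noInteriorMultiple? primes)
    ≡⟨ cong (negOnePow (length primes) *_) (𝟙-yes (noInteriorMultiple? primes) none) ⟩
      negOnePow (length primes) * 1ℤ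
    ≡⟨ trans (*-identityʳ (negOnePow (length primes))) (sym μℕ≡ε) ⟩
      μℕ s ∎
    where
    -- A squarefree s divides every common multiple of its prime divisors, so none lies strictly between 0 and s
    none : NoInteriorMultiple primes
    none i primes∣ = ℕₚ.<-irrefl refl (ℕₚ.<-≤-trans (s≤s (toℕ<n i)) (∣⇒≤ s∣))
      where
      s∣ : s ∣ suc (toℕ i)
      s∣ = squarefree⇒∣ (<-wellFounded s) (s≤s z≤n)
             (λ p p-prime p²∣s → squarefree (p , s≤s (ℕₚ.≤-trans (ℕₚ.m≤m*n p p {{prime⇒nonZero p-prime}}) (∣⇒≤ p²∣s)) ,
                                             p-prime , p²∣s))
             (suc (toℕ i)) (λ p p-prime p∣s → All.lookup primes∣ (∈primes⁺ (p-prime , p∣s)))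

μ-of-L≡μℕ : ∀ t → μ-of-L (suc (suc t)) ≡ μℕ (suc t)
μ-of-L≡μℕ t = trans (μP-⊥≡generatorSum ⊤ ⊤∈L) ∑-spanning≡μℕ
  where
  open APClosure
  open SpanningSets t
  open ClosureMoebius n IsAP? apHull apHull-isAP ⊆-apHull apHull-least ⊥-isAP
  ⊤∈L : ⊤ ∈ˡ L-elems n
  ⊤∈L = ∈-filter⁺ IsAP? (Sums.∈-allSubsets n ⊤) (⊤-isAP n)

theorem1 : μ-of-L 0 ≡ 1ℤ × μ-of-L 1 ≡ - 1ℤ × ((n : ℕ) → 2 ≤ n → μ-of-L n ≡ μℕ (n ∸ 1))
theorem1 = refl , refl , λ { (suc (suc t)) _ → μ-of-L≡μℕ t ; (suc zero) (s≤s ()) }
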